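{- Let $p\ge5$ be a prime with $p\not\equiv 1\pmod{12}$. Then for all integers $k,n\ge 0$ with $p\nmid n$, $$p_{1,1}\left(p^{2 k+1} n+\frac{p^{2 k+2}-1}{12}\right) \equiv 0 \pmod 2.$$
   Context: For a partition $\lambda$, $\mathrm{mex}_{1,1}(\lambda)$ is the smallest positive integer that is not a part of $\lambda$; $p_{1,1}(n)$ is the number of partitions $\lambda$ of $n$ with $\mathrm{mex}_{1,1}(\lambda)$ odd. -}

module Defs where

open import Data.Nat using (ℕ; zero; suc; _+_; _*_; _∸_; _≤?_)
open import Data.Nat.Properties using (_≟_)
open import Data.Bool using (Bool; true; false; if_then_else_)
open import Data.List using (List; []; _∷_; [_]; _++_; map; concatMap; filter; length; replicate; upTo)
open import Data.Bool.ListAction using (any)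
open import Relation.Nullary.Decidable using (⌊_⌋)

-- A partition is represented as a non-increasing list of positive parts.
-- partitionsBounded m n : the list of all partitions of n with every part ≤ m,
-- each listed exactly once: choose the multiplicity k of the part m, then
-- partition the remainder using parts ≤ m - 1.
partitionsBounded : ℕ → ℕ → List (List ℕ)
partitionsBounded zero zero = [ [] ]
partitionsBounded zero (suc _) = []
partitionsBounded (suc m) n =
  concatMap (λ k → map (replicate k (suc m) ++_) (partitionsBounded m (n ∸ k * suc m)))
            (filter (λ k → k * suc m ≤? n) (upTo (suc n)))

partitions : ℕ → List (List ℕ)
partitions n = partitionsBounded n n

_∈ᵇ_ : ℕ → List ℕ → Bool
k ∈ᵇ xs = any (λ x → ⌊ x ≟ k ⌋) xs

-- mex_{1,1}(λ): smallest positive integer not a part of λ.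
-- Searching from 1 with fuel (length λ + 1) suffices, since among
-- 1, …, length λ + 1 at least one value is not a part.
mexSearch : List ℕ → ℕ → ℕ → ℕ
mexSearch xs zero k = k
mexSearch xs (suc f) k = if k ∈ᵇ xs then mexSearch xs f (suc k) else k

mex₁₁ : List ℕ → ℕ
mex₁₁ xs = mexSearch xs (suc (length xs)) 1

isOdd : ℕ → Bool
isOdd zero = false
isOdd (suc n) = not′ (isOdd n)
  where
  not′ : Bool → Bool
  not′ true = false
  not′ false = true

p₁₁ : ℕ → ℕ
p₁₁ n = length (filter (λ λ′ → isOdd (mex₁₁ λ′) Data.Bool.≟ true) (partitions n))

-- Work in 𝔽₂[[q]], a series being its coefficient function ℕ → Bool, and put E_m = ∏_{i≤m} (1 + qⁱ),
-- ψ_m = Σ_{j≤m} q^{j(j+1)/2}. If A_m records the parity of the number of partitions of n into parts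
-- ≤ m with odd mex, sorting partitions by the multiplicity of the part m gives E_m A_m = ψ_m.
-- Jacobi's identity E³ ≡ ψ (mod 2), derived from the q-binomial theorem, then cancels E_m and
-- leaves A_m ≡ E_m² = E_m(q²) below degree m, so by Euler's pentagonal number theorem (in Shanks'
-- finite form) p₁₁(N) is odd only if N = 2h with 24h + 1 = 12N + 1 a square. For the N of the
-- theorem, 12N + 1 = p^(2k+1) (12n + p) with p ∤ 12n + p, which is not a square.
module Submission where

open import Defs
open import Data.Nat using (ℕ; _+_; _*_; _∸_; _^_; _≤_; _%_; _/_)
open import Data.Nat.Divisibility using (_∣_)
open import Data.Nat.Primality using (Prime)
open import Relation.Binary.PropositionalEquality using (_≢_)
open import Relation.Nullary using (¬_)

module Antidiagonal where

  open import Data.Nat using (ℕ; zero; suc; _+_)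
  open import Data.Nat.Properties using (+-suc)
  open import Data.Bool using (Bool; true; false; _∧_; _xor_)
  open import Data.Bool.Properties
    using (xor-assoc; xor-comm; xor-same; xor-identityʳ; ∧-distribˡ-xor; ∧-comm; xor-∧-commutativeRing)
  open import Algebra.Bundles using (CommutativeRing)
  open import Algebra.Properties.CommutativeSemigroup
    (CommutativeRing.+-commutativeSemigroup xor-∧-commutativeRing)
    renaming (interchange to xor-interchange) using ()
  open import Relation.Binary.PropositionalEquality
  open ≡-Reasoning

  xor-cancelˡ : ∀ a b c → a xor b ≡ a xor c → b ≡ c
  xor-cancelˡ false b c e = e
  xor-cancelˡ true false false e = refl
  xor-cancelˡ true true true e = refl

  antidiag : ℕ → (ℕ → ℕ → Bool) → Bool
  antidiag zero h = h 0 0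
  antidiag (suc n) h = h 0 (suc n) xor antidiag n (λ i j → h (suc i) j)

  antidiag-cong-on : ∀ n {h h′} → (∀ i j → i + j ≡ n → h i j ≡ h′ i j) →
                     antidiag n h ≡ antidiag n h′
  antidiag-cong-on zero e = e 0 0 refl
  antidiag-cong-on (suc n) e =
    cong₂ _xor_ (e 0 (suc n) refl) (antidiag-cong-on n (λ i j p → e (suc i) j (cong suc p)))

  antidiag-cong : ∀ n {h h′} → (∀ i j → h i j ≡ h′ i j) → antidiag n h ≡ antidiag n h′
  antidiag-cong n e = antidiag-cong-on n (λ i j _ → e i j)

  antidiag-xor : ∀ n h h′ →
    antidiag n (λ i j → h i j xor h′ i j) ≡ antidiag n h xor antidiag n h′
  antidiag-xor zero h h′ = refl
  antidiag-xor (suc n) h h′ = begin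
    (h 0 (suc n) xor h′ 0 (suc n)) xor antidiag n (λ i j → h (suc i) j xor h′ (suc i) j)
      ≡⟨ cong ((h 0 (suc n) xor h′ 0 (suc n)) xor_) (antidiag-xor n hₛ h′ₛ) ⟩
    (h 0 (suc n) xor h′ 0 (suc n)) xor (antidiag n hₛ xor antidiag n h′ₛ)
      ≡⟨ xor-interchange (h 0 (suc n)) (h′ 0 (suc n)) (antidiag n hₛ) (antidiag n h′ₛ) ⟩
    antidiag (suc n) h xor antidiag (suc n) h′ ∎
    where
    hₛ h′ₛ : ℕ → ℕ → Bool
    hₛ i j = h (suc i) j
    h′ₛ i j = h′ (suc i) j

  antidiag-∧ˡ : ∀ n b h → antidiag n (λ i j → b ∧ h i j) ≡ b ∧ antidiag n h
  antidiag-∧ˡ zero b h = refl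
  antidiag-∧ˡ (suc n) b h =
    trans (cong ((b ∧ h 0 (suc n)) xor_) (antidiag-∧ˡ n b (λ i j → h (suc i) j)))
          (sym (∧-distribˡ-xor b _ _))

  antidiag-∧ʳ : ∀ n b h → antidiag n (λ i j → h i j ∧ b) ≡ antidiag n h ∧ b
  antidiag-∧ʳ n b h =
    trans (antidiag-cong n (λ i j → ∧-comm (h i j) b)) (trans (antidiag-∧ˡ n b h) (∧-comm b _))

  antidiag-false : ∀ n → antidiag n (λ _ _ → false) ≡ false
  antidiag-false zero = refl
  antidiag-false (suc n) = antidiag-false n

  antidiag-suc-last : ∀ n h →
    antidiag (suc n) h ≡ antidiag n (λ i j → h i (suc j)) xor h (suc n) 0
  antidiag-suc-last zero h = refl
  antidiag-suc-last (suc n) h = begin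
    h 0 (suc (suc n)) xor antidiag (suc n) (λ i j → h (suc i) j)
      ≡⟨ cong (h 0 (suc (suc n)) xor_) (antidiag-suc-last n (λ i j → h (suc i) j)) ⟩
    h 0 (suc (suc n)) xor (antidiag n (λ i j → h (suc i) (suc j)) xor h (suc (suc n)) 0)
      ≡⟨ xor-assoc (h 0 (suc (suc n))) (antidiag n (λ i j → h (suc i) (suc j))) (h (suc (suc n)) 0) ⟨
    antidiag (suc n) (λ i j → h i (suc j)) xor h (suc (suc n)) 0 ∎

  antidiag-flip : ∀ n h → antidiag n h ≡ antidiag n (λ i j → h j i)
  antidiag-flip zero h = refl
  antidiag-flip (suc n) h = begin
    h 0 (suc n) xor antidiag n (λ i j → h (suc i) j)
      ≡⟨ cong (h 0 (suc n) xor_) (antidiag-flip n _) ⟩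
    h 0 (suc n) xor antidiag n (λ i j → h (suc j) i)
      ≡⟨ xor-comm (h 0 (suc n)) (antidiag n (λ i j → h (suc j) i)) ⟩
    antidiag n (λ i j → h (suc j) i) xor h 0 (suc n)
      ≡⟨ antidiag-suc-last n (λ i j → h j i) ⟨
    antidiag (suc n) (λ i j → h j i) ∎

  antidiag-assoc : ∀ n (h : ℕ → ℕ → ℕ → Bool) →
    antidiag n (λ a r → antidiag r (λ b c → h a b c)) ≡
    antidiag n (λ m c → antidiag m (λ a b → h a b c))
  antidiag-assoc zero h = refl
  antidiag-assoc (suc n) h = begin
    antidiag (suc n) (λ b c → h 0 b c) xor antidiag n (λ a r → antidiag r (λ b c → h (suc a) b c))
      ≡⟨ cong (antidiag (suc n) (λ b c → h 0 b c) xor_) (antidiag-assoc n (λ a b c → h (suc a) b c)) ⟩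
    (h 0 0 (suc n) xor antidiag n (λ b c → h 0 (suc b) c)) xor
      antidiag n (λ m c → antidiag m (λ a b → h (suc a) b c))
      ≡⟨ xor-assoc (h 0 0 (suc n)) (antidiag n (λ b c → h 0 (suc b) c)) _ ⟩
    h 0 0 (suc n) xor (antidiag n (λ b c → h 0 (suc b) c) xor
      antidiag n (λ m c → antidiag m (λ a b → h (suc a) b c)))
      ≡⟨ cong (h 0 0 (suc n) xor_) (antidiag-xor n (λ m c → h 0 (suc m) c) _) ⟨
    h 0 0 (suc n) xor antidiag n (λ m c → antidiag (suc m) (λ a b → h a b c)) ∎

  antidiag-swap : ∀ n L (h : ℕ → ℕ → ℕ → ℕ → Bool) →
    antidiag n (λ i j → antidiag L (h i j)) ≡ antidiag L (λ k l → antidiag n (λ i j → h i j k l))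
  antidiag-swap zero L h = refl
  antidiag-swap (suc n) L h = begin
    antidiag L (h 0 (suc n)) xor antidiag n (λ i j → antidiag L (h (suc i) j))
      ≡⟨ cong (antidiag L (h 0 (suc n)) xor_) (antidiag-swap n L (λ i j → h (suc i) j)) ⟩
    antidiag L (h 0 (suc n)) xor antidiag L (λ k l → antidiag n (λ i j → h (suc i) j k l))
      ≡⟨ antidiag-xor L (h 0 (suc n)) _ ⟨
    antidiag L (λ k l → antidiag (suc n) (λ i j → h i j k l)) ∎

  antidiag-symmetric : ∀ m h → (∀ i j → h i j ≡ h j i) →
    antidiag (suc (suc m)) h ≡ antidiag m (λ i j → h (suc i) (suc j))
  antidiag-symmetric m h h-sym = begin
    h 0 (suc (suc m)) xor antidiag (suc m) (λ i j → h (suc i) j)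
      ≡⟨ cong (h 0 (suc (suc m)) xor_) (antidiag-suc-last m (λ i j → h (suc i) j)) ⟩
    h 0 (suc (suc m)) xor (antidiag m (λ i j → h (suc i) (suc j)) xor h (suc (suc m)) 0)
      ≡⟨ cong (λ z → h 0 (suc (suc m)) xor (antidiag m (λ i j → h (suc i) (suc j)) xor z))
              (h-sym (suc (suc m)) 0) ⟩
    h 0 (suc (suc m)) xor (antidiag m (λ i j → h (suc i) (suc j)) xor h 0 (suc (suc m)))
      ≡⟨ xor-outer-cancel (h 0 (suc (suc m))) _ ⟩
    antidiag m (λ i j → h (suc i) (suc j)) ∎
    where
    xor-outer-cancel : ∀ x y → x xor (y xor x) ≡ y
    xor-outer-cancel true true = refl
    xor-outer-cancel true false = refl
    xor-outer-cancel false y = xor-identityʳ y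

  antidiag-symmetric-even : ∀ n h → (∀ i j → h i j ≡ h j i) → antidiag (n + n) h ≡ h n n
  antidiag-symmetric-even zero h h-sym = refl
  antidiag-symmetric-even (suc n) h h-sym = begin
    antidiag (suc n + suc n) h                    ≡⟨ cong (λ m → antidiag (suc m) h) (+-suc n n) ⟩
    antidiag (suc (suc (n + n))) h                ≡⟨ antidiag-symmetric (n + n) h h-sym ⟩
    antidiag (n + n) (λ i j → h (suc i) (suc j))
      ≡⟨ antidiag-symmetric-even n _ (λ i j → h-sym (suc i) (suc j)) ⟩
    h (suc n) (suc n)                             ∎

  antidiag-symmetric-odd : ∀ n h → (∀ i j → h i j ≡ h j i) → antidiag (suc (n + n)) h ≡ false
  antidiag-symmetric-odd zero h h-sym = trans (cong (h 0 1 xor_) (h-sym 1 0)) (xor-same (h 0 1))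
  antidiag-symmetric-odd (suc n) h h-sym = begin
    antidiag (suc (suc n + suc n)) h                    ≡⟨ cong (λ m → antidiag (suc (suc m)) h) (+-suc n n) ⟩
    antidiag (suc (suc (suc (n + n)))) h                ≡⟨ antidiag-symmetric (suc (n + n)) h h-sym ⟩
    antidiag (suc (n + n)) (λ i j → h (suc i) (suc j))
      ≡⟨ antidiag-symmetric-odd n _ (λ i j → h-sym (suc i) (suc j)) ⟩
    false                                               ∎

module Series where

  open import Data.Nat using (ℕ; zero; suc; _+_; _≤_; _<_; z≤n; s≤s; _≡ᵇ_)
  open import Data.Nat.Properties
  open import Data.Bool using (Bool; true; false; _∧_; _xor_)
  open import Data.Bool.Properties
    using (T-≡; xor-assoc; xor-comm; xor-same; xor-identityʳ; ∧-distribˡ-xor; ∧-comm; ∧-assoc)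
  open import Data.Product using (_,_)
  open import Data.Sum using (_⊎_; inj₁; inj₂)
  open import Function.Bundles using (Equivalence)
  open import Relation.Binary.PropositionalEquality
  open import Relation.Binary.Bundles using (Setoid)
  open import Algebra.Bundles using (CommutativeMonoid)
  open Antidiagonal

  Series : Set
  Series = ℕ → Bool

  infix 4 _≈_ _≈[_]_
  record _≈_ (f g : Series) : Set where
    constructor mk≈
    field coeff : ∀ n → f n ≡ g n
  open _≈_ public

  record _≈[_]_ (f : Series) (N : ℕ) (g : Series) : Set where
    constructor mk≈[]
    field coeff≤ : ∀ n → n ≤ N → f n ≡ g n
  open _≈[_]_ public

  infixl 6 _⊕_
  infixl 7 _⊛_

  opaque
    _⊕_ : Series → Series → Series
    (f ⊕ g) n = f n xor g n

    _⊛_ : Series → Series → Series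
    (f ⊛ g) n = antidiag n (λ i j → f i ∧ g j)

    X : ℕ → Series
    X k n = n ≡ᵇ k

  𝟘 : Series
  𝟘 _ = false

  𝟙 : Series
  𝟙 = X 0

  shift : ℕ → Series → Series
  shift zero f = f
  shift (suc k) f zero = false
  shift (suc k) f (suc n) = shift k f n

  antidiagSum : ℕ → (ℕ → ℕ → Series) → Series
  antidiagSum L F n = antidiag L (λ k j → F k j n)

  ≈-refl : ∀ {f} → f ≈ f
  ≈-refl = mk≈ (λ n → refl)

  ≈-sym : ∀ {f g} → f ≈ g → g ≈ f
  ≈-sym e = mk≈ (λ n → sym (coeff e n))

  ≈-trans : ∀ {f g h} → f ≈ g → g ≈ h → f ≈ h
  ≈-trans e e′ = mk≈ (λ n → trans (coeff e n) (coeff e′ n))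

  ≡⇒≈ : ∀ {f g} → f ≡ g → f ≈ g
  ≡⇒≈ refl = ≈-refl

  Series-setoid : Setoid _ _
  Series-setoid = record
    { Carrier = Series ; _≈_ = _≈_
    ; isEquivalence = record { refl = ≈-refl ; sym = ≈-sym ; trans = ≈-trans } }

  opaque
    unfolding _⊕_ _⊛_ X

    ⊕-coeff : ∀ f g n → (f ⊕ g) n ≡ f n xor g n
    ⊕-coeff f g n = refl

    ⊛-coeff : ∀ f g n → (f ⊛ g) n ≡ antidiag n (λ i j → f i ∧ g j)
    ⊛-coeff f g n = refl

    X-coeff : ∀ k n → X k n ≡ (n ≡ᵇ k)
    X-coeff k n = refl

    ⊕-cong : ∀ {f f′ g g′} → f ≈ f′ → g ≈ g′ → f ⊕ g ≈ f′ ⊕ g′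
    ⊕-cong e e′ = mk≈ (λ n → cong₂ _xor_ (coeff e n) (coeff e′ n))

    ⊛-cong : ∀ {f f′ g g′} → f ≈ f′ → g ≈ g′ → f ⊛ g ≈ f′ ⊛ g′
    ⊛-cong e e′ = mk≈ (λ n → antidiag-cong n (λ i j → cong₂ _∧_ (coeff e i) (coeff e′ j)))

    ⊕-comm : ∀ f g → f ⊕ g ≈ g ⊕ f
    ⊕-comm f g = mk≈ (λ n → xor-comm (f n) (g n))

    ⊕-assoc : ∀ f g h → (f ⊕ g) ⊕ h ≈ f ⊕ (g ⊕ h)
    ⊕-assoc f g h = mk≈ (λ n → xor-assoc (f n) (g n) (h n))

    ⊕-self : ∀ f → f ⊕ f ≈ 𝟘
    ⊕-self f = mk≈ (λ n → xor-same (f n))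

    ⊕-identityˡ : ∀ f → 𝟘 ⊕ f ≈ f
    ⊕-identityˡ f = mk≈ (λ n → refl)

    ⊕-identityʳ : ∀ f → f ⊕ 𝟘 ≈ f
    ⊕-identityʳ f = mk≈ (λ n → xor-identityʳ (f n))

    ⊛-comm : ∀ f g → f ⊛ g ≈ g ⊛ f
    ⊛-comm f g = mk≈ (λ n → trans (antidiag-flip n _) (antidiag-cong n (λ i j → ∧-comm (f j) (g i))))

    ⊛-distribˡ-⊕ : ∀ f g h → f ⊛ (g ⊕ h) ≈ f ⊛ g ⊕ f ⊛ h
    ⊛-distribˡ-⊕ f g h =
      mk≈ (λ n → trans (antidiag-cong n (λ i j → ∧-distribˡ-xor (f i) (g j) (h j))) (antidiag-xor n _ _))

    ⊛-assoc : ∀ f g h → (f ⊛ g) ⊛ h ≈ f ⊛ (g ⊛ h)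
    ⊛-assoc f g h = mk≈ λ n → begin
      antidiag n (λ m c → antidiag m (λ a b → f a ∧ g b) ∧ h c)
        ≡⟨ antidiag-cong n (λ m c → antidiag-∧ʳ m (h c) (λ a b → f a ∧ g b)) ⟨
      antidiag n (λ m c → antidiag m (λ a b → (f a ∧ g b) ∧ h c))
        ≡⟨ antidiag-assoc n (λ a b c → (f a ∧ g b) ∧ h c) ⟨
      antidiag n (λ a r → antidiag r (λ b c → (f a ∧ g b) ∧ h c))
        ≡⟨ antidiag-cong n (λ a r → trans (antidiag-cong r (λ b c → ∧-assoc (f a) (g b) (h c)))
                                          (antidiag-∧ˡ r (f a) (λ b c → g b ∧ h c))) ⟩
      antidiag n (λ a r → f a ∧ antidiag r (λ b c → g b ∧ h c)) ∎
      where open ≡-Reasoning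

    ⊛-zeroˡ : ∀ f → 𝟘 ⊛ f ≈ 𝟘
    ⊛-zeroˡ f = mk≈ (λ n → antidiag-false n)

    X⊛-coeff : ∀ k f n → (X k ⊛ f) n ≡ shift k f n
    X⊛-coeff zero f zero = refl
    X⊛-coeff zero f (suc n) = trans (cong (f (suc n) xor_) (antidiag-false n)) (xor-identityʳ _)
    X⊛-coeff (suc k) f zero = refl
    X⊛-coeff (suc k) f (suc n) = X⊛-coeff k f n

    ⊛-congˡ-≈[] : ∀ f {g g′ N} → g ≈[ N ] g′ → f ⊛ g ≈[ N ] f ⊛ g′
    ⊛-congˡ-≈[] f e = mk≈[] (λ n p → antidiag-cong-on n (λ i j q →
      cong (f i ∧_) (coeff≤ e j (≤-trans (subst (j ≤_) q (m≤n+m j i)) p))))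

    ⊛-cancelˡ-step : ∀ c {x y} N → c 0 ≡ true → x ≈[ N ] y →
                     (c ⊛ x) (suc N) ≡ (c ⊛ y) (suc N) → x (suc N) ≡ y (suc N)
    ⊛-cancelˡ-step c {x} {y} N c₀ e e′ = begin
      x (suc N)       ≡⟨ cong (_∧ x (suc N)) c₀ ⟨
      c 0 ∧ x (suc N) ≡⟨ xor-cancelˡ lowerˣ _ _ same-top ⟩
      c 0 ∧ y (suc N) ≡⟨ cong (_∧ y (suc N)) c₀ ⟩
      y (suc N)       ∎
      where
      open ≡-Reasoning
      lowerˣ lowerʸ : Bool
      lowerˣ = antidiag N (λ i j → c (suc i) ∧ x j)
      lowerʸ = antidiag N (λ i j → c (suc i) ∧ y j)
      lower-≡ : lowerˣ ≡ lowerʸ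
      lower-≡ = antidiag-cong-on N (λ i j q →
        cong (c (suc i) ∧_) (coeff≤ e j (subst (j ≤_) q (m≤n+m j i))))
      same-top : lowerˣ xor (c 0 ∧ x (suc N)) ≡ lowerˣ xor (c 0 ∧ y (suc N))
      same-top = trans (xor-comm lowerˣ _) (trans e′
        (trans (cong ((c 0 ∧ y (suc N)) xor_) (sym lower-≡)) (xor-comm _ lowerˣ)))

    antidiagSum-suc : ∀ L F → antidiagSum (suc L) F ≈ F 0 (suc L) ⊕ antidiagSum L (λ k j → F (suc k) j)
    antidiagSum-suc L F = ≈-refl

    antidiagSum-suc-last : ∀ L F →
      antidiagSum (suc L) F ≈ antidiagSum L (λ k j → F k (suc j)) ⊕ F (suc L) 0
    antidiagSum-suc-last L F = mk≈ (λ n → antidiag-suc-last L (λ k j → F k j n))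

    antidiagSum-⊕ : ∀ L F F′ →
      antidiagSum L (λ k j → F k j ⊕ F′ k j) ≈ antidiagSum L F ⊕ antidiagSum L F′
    antidiagSum-⊕ L F F′ = mk≈ (λ n → antidiag-xor L (λ k j → F k j n) (λ k j → F′ k j n))

    ⊛-antidiagSum : ∀ f L F → f ⊛ antidiagSum L F ≈ antidiagSum L (λ k j → f ⊛ F k j)
    ⊛-antidiagSum f L F = mk≈ (λ n →
      trans (antidiag-cong n (λ i j → sym (antidiag-∧ˡ L (f i) (λ k l → F k l j))))
            (antidiag-swap n L (λ i j k l → f i ∧ F k l j)))

  X⊛≈shift : ∀ k f → X k ⊛ f ≈ shift k f
  X⊛≈shift k f = mk≈ (X⊛-coeff k f)

  ⊛-identityˡ : ∀ f → 𝟙 ⊛ f ≈ f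
  ⊛-identityˡ f = X⊛≈shift 0 f

  ⊛-identityʳ : ∀ f → f ⊛ 𝟙 ≈ f
  ⊛-identityʳ f = ≈-trans (⊛-comm f 𝟙) (⊛-identityˡ f)

  ⊛-zeroʳ : ∀ f → f ⊛ 𝟘 ≈ 𝟘
  ⊛-zeroʳ f = ≈-trans (⊛-comm f 𝟘) (⊛-zeroˡ f)

  ⊛-distribʳ-⊕ : ∀ f g h → (g ⊕ h) ⊛ f ≈ g ⊛ f ⊕ h ⊛ f
  ⊛-distribʳ-⊕ f g h = ≈-trans (⊛-comm (g ⊕ h) f)
    (≈-trans (⊛-distribˡ-⊕ f g h) (⊕-cong (⊛-comm f g) (⊛-comm f h)))

  ⊛-swapˡ : ∀ f g h → f ⊛ (g ⊛ h) ≈ g ⊛ (f ⊛ h)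
  ⊛-swapˡ f g h = ≈-trans (≈-sym (⊛-assoc f g h)) (≈-trans (⊛-cong (⊛-comm f g) ≈-refl) (⊛-assoc g f h))

  ⊛-commutativeMonoid : CommutativeMonoid _ _
  ⊛-commutativeMonoid = record
    { Carrier = Series ; _≈_ = _≈_ ; _∙_ = _⊛_ ; ε = 𝟙
    ; isCommutativeMonoid = record
      { isMonoid = record
        { isSemigroup = record
          { isMagma = record { isEquivalence = Setoid.isEquivalence Series-setoid ; ∙-cong = ⊛-cong }
          ; assoc = ⊛-assoc }
        ; identity = ⊛-identityˡ , ⊛-identityʳ }
      ; comm = ⊛-comm } }

  ⊕-cancel-middle : ∀ u v w → (u ⊕ v) ⊕ (v ⊕ w) ≈ u ⊕ w
  ⊕-cancel-middle u v w = mk≈ λ n → begin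
    ((u ⊕ v) ⊕ (v ⊕ w)) n
      ≡⟨ trans (⊕-coeff (u ⊕ v) (v ⊕ w) n) (cong₂ _xor_ (⊕-coeff u v n) (⊕-coeff v w n)) ⟩
    (u n xor v n) xor (v n xor w n)
      ≡⟨ xor-cancel-middle (u n) (v n) (w n) ⟩
    u n xor w n
      ≡⟨ ⊕-coeff u w n ⟨
    (u ⊕ w) n ∎
    where
    open ≡-Reasoning
    xor-cancel-middle : ∀ a b c → (a xor b) xor (b xor c) ≡ a xor c
    xor-cancel-middle false false c = refl
    xor-cancel-middle false true false = refl
    xor-cancel-middle false true true = refl
    xor-cancel-middle true false false = refl
    xor-cancel-middle true false true = refl
    xor-cancel-middle true true false = refl
    xor-cancel-middle true true true = refl

  ⊕-cancelˡ : ∀ u v → u ⊕ (u ⊕ v) ≈ v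
  ⊕-cancelˡ u v =
    ≈-trans (≈-sym (⊕-assoc u u v)) (≈-trans (⊕-cong (⊕-self u) ≈-refl) (⊕-identityˡ v))

  ⊕-move : ∀ {u v w} → u ≈ v ⊕ w → v ≈ u ⊕ w
  ⊕-move {u} {v} {w} e = ≈-trans (≈-sym (⊕-cancelˡ w v))
    (≈-trans (⊕-comm w (w ⊕ v)) (⊕-cong (≈-trans (⊕-comm w v) (≈-sym e)) ≈-refl))

  shift-below : ∀ k f n → n < k → shift k f n ≡ false
  shift-below (suc k) f zero _ = refl
  shift-below (suc k) f (suc n) (s≤s p) = shift-below k f n p

  shift-+ : ∀ k f n → shift k f (k + n) ≡ f n
  shift-+ zero f n = refl
  shift-+ (suc k) f n = shift-+ k f n

  shift-cong : ∀ k {f g} → f ≈ g → shift k f ≈ shift k g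
  shift-cong k {f} {g} e = mk≈ (go k)
    where
    go : ∀ k n → shift k f n ≡ shift k g n
    go zero n = coeff e n
    go (suc k) zero = refl
    go (suc k) (suc n) = go k n

  shift-shift : ∀ a b f → shift a (shift b f) ≈ shift (a + b) f
  shift-shift a b f = mk≈ (go a)
    where
    go : ∀ a n → shift a (shift b f) n ≡ shift (a + b) f n
    go zero n = refl
    go (suc a) zero = refl
    go (suc a) (suc n) = go a n

  X≈shift𝟙 : ∀ k → X k ≈ shift k 𝟙
  X≈shift𝟙 k = ≈-trans (≈-sym (⊛-identityʳ (X k))) (X⊛≈shift k 𝟙)

  X⊛X : ∀ a b → X a ⊛ X b ≈ X (a + b)
  X⊛X a b = ≈-trans (X⊛≈shift a (X b)) (≈-trans (shift-cong a (X≈shift𝟙 b))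
    (≈-trans (shift-shift a b 𝟙) (≈-sym (X≈shift𝟙 (a + b)))))

  X-cong : ∀ {a b} → a ≡ b → X a ≈ X b
  X-cong refl = ≈-refl

  X⊛X⊛ : ∀ a b g → X a ⊛ (X b ⊛ g) ≈ X (a + b) ⊛ g
  X⊛X⊛ a b g = ≈-trans (≈-sym (⊛-assoc (X a) (X b) g)) (⊛-cong (X⊛X a b) ≈-refl)

  ⊛-coeff-0 : ∀ f g → f 0 ≡ true → g 0 ≡ true → (f ⊛ g) 0 ≡ true
  ⊛-coeff-0 f g e e′ = trans (⊛-coeff f g 0) (cong₂ _∧_ e e′)

  X-coeff-true : ∀ k m → X k m ≡ true → m ≡ k
  X-coeff-true k m e = ≡ᵇ⇒≡ m k (Equivalence.from T-≡ (trans (sym (X-coeff k m)) e))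

  ⊕-coeff-true : ∀ f g m → (f ⊕ g) m ≡ true → f m ≡ true ⊎ g m ≡ true
  ⊕-coeff-true f g m e with f m | g m | trans (sym (⊕-coeff f g m)) e
  ... | true  | _    | _ = inj₁ refl
  ... | false | true | _ = inj₂ refl

  ≈[]-refl : ∀ {f N} → f ≈[ N ] f
  ≈[]-refl = mk≈[] (λ n _ → refl)

  ≈[]-sym : ∀ {f g N} → f ≈[ N ] g → g ≈[ N ] f
  ≈[]-sym e = mk≈[] (λ n p → sym (coeff≤ e n p))

  ≈[]-trans : ∀ {f g h N} → f ≈[ N ] g → g ≈[ N ] h → f ≈[ N ] h
  ≈[]-trans e e′ = mk≈[] (λ n p → trans (coeff≤ e n p) (coeff≤ e′ n p))

  ≈⇒≈[] : ∀ {f g N} → f ≈ g → f ≈[ N ] g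
  ≈⇒≈[] e = mk≈[] (λ n _ → coeff e n)

  ≈[]-mono : ∀ {f g N M} → M ≤ N → f ≈[ N ] g → f ≈[ M ] g
  ≈[]-mono q e = mk≈[] (λ n p → coeff≤ e n (≤-trans p q))

  ⊕-cong-≈[] : ∀ {f f′ g g′ N} → f ≈[ N ] f′ → g ≈[ N ] g′ → f ⊕ g ≈[ N ] f′ ⊕ g′
  ⊕-cong-≈[] {f} {f′} {g} {g′} e e′ = mk≈[] (λ n p → trans (⊕-coeff f g n)
    (trans (cong₂ _xor_ (coeff≤ e n p) (coeff≤ e′ n p)) (sym (⊕-coeff f′ g′ n))))

  ⊛-cong-≈[] : ∀ {f f′ g g′ N} → f ≈[ N ] f′ → g ≈[ N ] g′ → f ⊛ g ≈[ N ] f′ ⊛ g′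
  ⊛-cong-≈[] {f} {f′} {g} {g′} e e′ =
    ≈[]-trans (⊛-congˡ-≈[] f e′) (≈[]-trans (≈⇒≈[] (⊛-comm f g′))
      (≈[]-trans (⊛-congˡ-≈[] g′ e) (≈⇒≈[] (⊛-comm g′ f′))))

  X⊛≈[]𝟘 : ∀ a f N → N < a → X a ⊛ f ≈[ N ] 𝟘
  X⊛≈[]𝟘 a f N q = mk≈[] (λ n p → trans (X⊛-coeff a f n) (shift-below a f n (≤-<-trans p q)))

  ⊛-cancelˡ-≈[] : ∀ c {x y} → c 0 ≡ true → ∀ N → c ⊛ x ≈[ N ] c ⊛ y → x ≈[ N ] y
  ⊛-cancelˡ-≈[] c {x} {y} c₀ zero e = mk≈[] λ { zero _ →
    trans (cong (_∧ x 0) (sym c₀))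
      (trans (sym (⊛-coeff c x 0)) (trans (coeff≤ e 0 z≤n) (trans (⊛-coeff c y 0) (cong (_∧ y 0) c₀)))) }
  ⊛-cancelˡ-≈[] c {x} {y} c₀ (suc N) e = mk≈[] go
    where
    below : x ≈[ N ] y
    below = ⊛-cancelˡ-≈[] c c₀ N (≈[]-mono (n≤1+n N) e)
    go : ∀ n → n ≤ suc N → x n ≡ y n
    go n p with m≤n⇒m<n∨m≡n p
    ... | inj₁ q = coeff≤ below n (m<1+n⇒m≤n q)
    ... | inj₂ refl = ⊛-cancelˡ-step c N c₀ below (coeff≤ e (suc N) ≤-refl)

  ⊛-cancelˡ : ∀ c {x y} → c 0 ≡ true → c ⊛ x ≈ c ⊛ y → x ≈ y
  ⊛-cancelˡ c c₀ e = mk≈ (λ n → coeff≤ (⊛-cancelˡ-≈[] c c₀ n (≈⇒≈[] e)) n ≤-refl)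

  antidiagSum-cong-on : ∀ L {F F′} → (∀ k j → k + j ≡ L → F k j ≈ F′ k j) →
                        antidiagSum L F ≈ antidiagSum L F′
  antidiagSum-cong-on L e = mk≈ (λ n → antidiag-cong-on L (λ k j q → coeff (e k j q) n))

  antidiagSum-cong-on-≈[] : ∀ L {F F′ N} → (∀ k j → k + j ≡ L → F k j ≈[ N ] F′ k j) →
                            antidiagSum L F ≈[ N ] antidiagSum L F′
  antidiagSum-cong-on-≈[] L e = mk≈[] (λ n p → antidiag-cong-on L (λ k j q → coeff≤ (e k j q) n p))

  antidiagSum-assoc : ∀ n (H : ℕ → ℕ → ℕ → Series) →
    antidiagSum n (λ a r → antidiagSum r (λ b c → H a b c)) ≈
    antidiagSum n (λ m c → antidiagSum m (λ a b → H a b c))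
  antidiagSum-assoc n H = mk≈ (λ t → antidiag-assoc n (λ a b c → H a b c t))

  antidiagSum-𝟘 : ∀ L → antidiagSum L (λ _ _ → 𝟘) ≈ 𝟘
  antidiagSum-𝟘 L = mk≈ (λ n → antidiag-false L)

module QBinomial where

  open import Data.Nat using (ℕ; zero; suc; _+_; _*_)
  open import Data.Nat.Properties using (+-identityʳ; +-suc; +-assoc; +-comm; *-zeroʳ)
  open import Data.Nat.Solver using (module +-*-Solver)
  open import Data.Bool using (true; _xor_)
  open import Relation.Binary.PropositionalEquality
    using (_≡_; refl; sym; trans; cong; cong₂)
  open Series
  open import Algebra.Solver.CommutativeMonoid ⊛-commutativeMonoid
    using (solve; _⊜_) renaming (_⊕_ to _⊗_)
  open import Relation.Binary.Reasoning.Setoid Series-setoid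
  open +-*-Solver using (_:=_; _:+_; _:*_; con) renaming (solve to solveℕ)

  factor : ℕ → Series
  factor k = 𝟙 ⊕ X k

  eulerProd : ℕ → Series
  eulerProd zero = 𝟙
  eulerProd (suc n) = eulerProd n ⊛ factor (suc n)

  eulerProdFrom : ℕ → ℕ → Series
  eulerProdFrom a zero = 𝟙
  eulerProdFrom a (suc L) = factor (suc a) ⊛ eulerProdFrom (suc a) L

  -- gaussBinom a b is the Gaussian binomial coefficient [a + b choose a] reduced mod 2.
  gaussBinom : ℕ → ℕ → Series
  gaussBinom zero b = 𝟙
  gaussBinom (suc a) zero = 𝟙
  gaussBinom (suc a) (suc b) = gaussBinom a (suc b) ⊕ X (suc a) ⊛ gaussBinom (suc a) b

  tri : ℕ → ℕ
  tri zero = 0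
  tri (suc n) = suc n + tri n

  factor-coeff-0 : ∀ k → factor (suc k) 0 ≡ true
  factor-coeff-0 k = trans (⊕-coeff 𝟙 (X (suc k)) 0) (cong₂ _xor_ (X-coeff 0 0) (X-coeff (suc k) 0))

  eulerProd-coeff-0 : ∀ n → eulerProd n 0 ≡ true
  eulerProd-coeff-0 zero = X-coeff 0 0
  eulerProd-coeff-0 (suc n) = ⊛-coeff-0 (eulerProd n) _ (eulerProd-coeff-0 n) (factor-coeff-0 n)

  factor⊛ : ∀ d g → factor d ⊛ g ≈ g ⊕ X d ⊛ g
  factor⊛ d g = ≈-trans (⊛-distribʳ-⊕ g 𝟙 (X d)) (⊕-cong (⊛-identityˡ g) ≈-refl)

  factor-+ : ∀ a b → factor a ⊕ X a ⊛ factor b ≈ factor (a + b)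
  factor-+ a b = begin
    (𝟙 ⊕ X a) ⊕ X a ⊛ (𝟙 ⊕ X b)         ≈⟨ ⊕-cong ≈-refl (⊛-distribˡ-⊕ (X a) 𝟙 (X b)) ⟩
    (𝟙 ⊕ X a) ⊕ (X a ⊛ 𝟙 ⊕ X a ⊛ X b)  ≈⟨ ⊕-cong ≈-refl (⊕-cong (⊛-identityʳ (X a)) (X⊛X a b)) ⟩
    (𝟙 ⊕ X a) ⊕ (X a ⊕ X (a + b))      ≈⟨ ⊕-cancel-middle 𝟙 (X a) (X (a + b)) ⟩
    𝟙 ⊕ X (a + b)                      ∎

  eulerProd-+ : ∀ a b → eulerProd (a + b) ≈ eulerProd a ⊛ eulerProdFrom a b
  eulerProd-+ a zero = begin
    eulerProd (a + 0) ≈⟨ ≡⇒≈ (cong eulerProd (+-identityʳ a)) ⟩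
    eulerProd a       ≈⟨ ⊛-identityʳ (eulerProd a) ⟨
    eulerProd a ⊛ 𝟙   ∎
  eulerProd-+ a (suc b) = begin
    eulerProd (a + suc b)                                             ≈⟨ ≡⇒≈ (cong eulerProd (+-suc a b)) ⟩
    eulerProd (suc a + b)                                             ≈⟨ eulerProd-+ (suc a) b ⟩
    (eulerProd a ⊛ factor (suc a)) ⊛ eulerProdFrom (suc a) b          ≈⟨ ⊛-assoc _ _ _ ⟩
    eulerProd a ⊛ (factor (suc a) ⊛ eulerProdFrom (suc a) b)          ∎

  eulerProdFrom-suc-last : ∀ a L → eulerProdFrom a (suc L) ≈ eulerProdFrom a L ⊛ factor (suc (a + L))
  eulerProdFrom-suc-last a zero = begin
    factor (suc a) ⊛ 𝟙        ≈⟨ ⊛-identityʳ _ ⟩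
    factor (suc a)            ≈⟨ ≡⇒≈ (cong (λ z → factor (suc z)) (+-identityʳ a)) ⟨
    factor (suc (a + 0))      ≈⟨ ⊛-identityˡ _ ⟨
    𝟙 ⊛ factor (suc (a + 0))  ∎
  eulerProdFrom-suc-last a (suc L) = begin
    factor (suc a) ⊛ eulerProdFrom (suc a) (suc L)
      ≈⟨ ⊛-cong ≈-refl (eulerProdFrom-suc-last (suc a) L) ⟩
    factor (suc a) ⊛ (eulerProdFrom (suc a) L ⊛ factor (suc (suc a + L)))
      ≈⟨ ⊛-assoc _ _ _ ⟨
    (factor (suc a) ⊛ eulerProdFrom (suc a) L) ⊛ factor (suc (suc a + L))
      ≈⟨ ≡⇒≈ (cong (λ z → (factor (suc a) ⊛ eulerProdFrom (suc a) L) ⊛ factor (suc z)) (+-suc a L)) ⟨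
    (factor (suc a) ⊛ eulerProdFrom (suc a) L) ⊛ factor (suc (a + suc L)) ∎

  gaussBinom-eulerProd : ∀ a b → gaussBinom a b ⊛ (eulerProd a ⊛ eulerProd b) ≈ eulerProd (a + b)
  gaussBinom-eulerProd zero b = ≈-trans (⊛-identityˡ _) (⊛-identityˡ _)
  gaussBinom-eulerProd (suc a) zero =
    ≈-trans (⊛-identityˡ _) (≈-trans (⊛-identityʳ _) (≡⇒≈ (cong eulerProd (sym (+-identityʳ (suc a))))))
  gaussBinom-eulerProd (suc a) (suc b) = begin
    (gaussBinom a (suc b) ⊕ X (suc a) ⊛ gaussBinom (suc a) b) ⊛ (eulerProd (suc a) ⊛ eulerProd (suc b))
      ≈⟨ ⊛-distribʳ-⊕ _ _ _ ⟩
    gaussBinom a (suc b) ⊛ ((eulerProd a ⊛ factor (suc a)) ⊛ eulerProd (suc b)) ⊕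
    (X (suc a) ⊛ gaussBinom (suc a) b) ⊛ (eulerProd (suc a) ⊛ (eulerProd b ⊛ factor (suc b)))
      ≈⟨ ⊕-cong (regroupˡ _ _ _ _) (regroupʳ _ _ _ _ _) ⟩
    (gaussBinom a (suc b) ⊛ (eulerProd a ⊛ eulerProd (suc b))) ⊛ factor (suc a) ⊕
    (gaussBinom (suc a) b ⊛ (eulerProd (suc a) ⊛ eulerProd b)) ⊛ (X (suc a) ⊛ factor (suc b))
      ≈⟨ ⊕-cong (⊛-cong (≈-trans (gaussBinom-eulerProd a (suc b)) (≡⇒≈ (cong eulerProd (+-suc a b)))) ≈-refl)
                (⊛-cong (gaussBinom-eulerProd (suc a) b) ≈-refl) ⟩
    eulerProd (suc (a + b)) ⊛ factor (suc a) ⊕ eulerProd (suc (a + b)) ⊛ (X (suc a) ⊛ factor (suc b))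
      ≈⟨ ⊛-distribˡ-⊕ _ _ _ ⟨
    eulerProd (suc (a + b)) ⊛ (factor (suc a) ⊕ X (suc a) ⊛ factor (suc b))
      ≈⟨ ⊛-cong ≈-refl (≈-trans (factor-+ (suc a) (suc b)) (≡⇒≈ (cong factor (cong suc (+-suc a b))))) ⟩
    eulerProd (suc (suc (a + b)))
      ≈⟨ ≡⇒≈ (cong (λ m → eulerProd (suc m)) (+-suc a b)) ⟨
    eulerProd (suc a + suc b)
      ∎
    where
    regroupˡ : ∀ g e o f → g ⊛ ((e ⊛ o) ⊛ f) ≈ (g ⊛ (e ⊛ f)) ⊛ o
    regroupˡ = solve 4 (λ g e o f → g ⊗ ((e ⊗ o) ⊗ f) ⊜ (g ⊗ (e ⊗ f)) ⊗ o) ≈-refl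
    regroupʳ : ∀ x g e f o → (x ⊛ g) ⊛ (e ⊛ (f ⊛ o)) ≈ (g ⊛ (e ⊛ f)) ⊛ (x ⊛ o)
    regroupʳ = solve 5 (λ x g e f o → (x ⊗ g) ⊗ (e ⊗ (f ⊗ o)) ⊜ (g ⊗ (e ⊗ f)) ⊗ (x ⊗ o)) ≈-refl

  gaussBinom-eulerProdˡ : ∀ a b → gaussBinom a b ⊛ eulerProd a ≈ eulerProdFrom b a
  gaussBinom-eulerProdˡ a b = ⊛-cancelˡ (eulerProd b) (eulerProd-coeff-0 b) (begin
    eulerProd b ⊛ (gaussBinom a b ⊛ eulerProd a)  ≈⟨ rotate _ _ _ ⟩
    gaussBinom a b ⊛ (eulerProd a ⊛ eulerProd b)  ≈⟨ gaussBinom-eulerProd a b ⟩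
    eulerProd (a + b)                             ≈⟨ ≡⇒≈ (cong eulerProd (+-comm a b)) ⟩
    eulerProd (b + a)                             ≈⟨ eulerProd-+ b a ⟩
    eulerProd b ⊛ eulerProdFrom b a               ∎)
    where
    rotate : ∀ e g f → e ⊛ (g ⊛ f) ≈ g ⊛ (f ⊛ e)
    rotate = solve 3 (λ e g f → e ⊗ (g ⊗ f) ⊜ g ⊗ (f ⊗ e)) ≈-refl

  gaussBinom-trinomial : ∀ n k j →
    gaussBinom n (k + j) ⊛ gaussBinom k j ≈ gaussBinom (n + k) j ⊛ gaussBinom n k
  gaussBinom-trinomial n k j = ⊛-cancelˡ Eₙₖⱼ Eₙₖⱼ-coeff-0 (begin
    Eₙₖⱼ ⊛ (gaussBinom n (k + j) ⊛ gaussBinom k j)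
      ≈⟨ regroup₁ (eulerProd n) (eulerProd k) (eulerProd j) _ _ ⟩
    gaussBinom n (k + j) ⊛ (eulerProd n ⊛ (gaussBinom k j ⊛ (eulerProd k ⊛ eulerProd j)))
      ≈⟨ ⊛-cong ≈-refl (⊛-cong ≈-refl (gaussBinom-eulerProd k j)) ⟩
    gaussBinom n (k + j) ⊛ (eulerProd n ⊛ eulerProd (k + j))
      ≈⟨ gaussBinom-eulerProd n (k + j) ⟩
    eulerProd (n + (k + j))
      ≈⟨ ≡⇒≈ (cong eulerProd (+-assoc n k j)) ⟨
    eulerProd (n + k + j)
      ≈⟨ gaussBinom-eulerProd (n + k) j ⟨
    gaussBinom (n + k) j ⊛ (eulerProd (n + k) ⊛ eulerProd j)
      ≈⟨ ⊛-cong ≈-refl (⊛-cong (gaussBinom-eulerProd n k) ≈-refl) ⟨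
    gaussBinom (n + k) j ⊛ ((gaussBinom n k ⊛ (eulerProd n ⊛ eulerProd k)) ⊛ eulerProd j)
      ≈⟨ regroup₂ (eulerProd n) (eulerProd k) (eulerProd j) _ _ ⟨
    Eₙₖⱼ ⊛ (gaussBinom (n + k) j ⊛ gaussBinom n k) ∎)
    where
    Eₙₖⱼ = eulerProd n ⊛ (eulerProd k ⊛ eulerProd j)
    Eₙₖⱼ-coeff-0 : Eₙₖⱼ 0 ≡ true
    Eₙₖⱼ-coeff-0 = ⊛-coeff-0 (eulerProd n) _ (eulerProd-coeff-0 n)
      (⊛-coeff-0 (eulerProd k) (eulerProd j) (eulerProd-coeff-0 k) (eulerProd-coeff-0 j))
    regroup₁ : ∀ en ek ej g₁ g₂ → (en ⊛ (ek ⊛ ej)) ⊛ (g₁ ⊛ g₂) ≈ g₁ ⊛ (en ⊛ (g₂ ⊛ (ek ⊛ ej)))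
    regroup₁ = solve 5 (λ en ek ej g₁ g₂ → (en ⊗ (ek ⊗ ej)) ⊗ (g₁ ⊗ g₂) ⊜ g₁ ⊗ (en ⊗ (g₂ ⊗ (ek ⊗ ej))))
                       ≈-refl
    regroup₂ : ∀ en ek ej g₁ g₂ → (en ⊛ (ek ⊛ ej)) ⊛ (g₁ ⊛ g₂) ≈ g₁ ⊛ ((g₂ ⊛ (en ⊛ ek)) ⊛ ej)
    regroup₂ = solve 5 (λ en ek ej g₁ g₂ → (en ⊗ (ek ⊗ ej)) ⊗ (g₁ ⊗ g₂) ⊜ g₁ ⊗ ((g₂ ⊗ (en ⊗ ek)) ⊗ ej))
                       ≈-refl

  gaussBinomStep : ℕ → ℕ → Series
  gaussBinomStep k zero = 𝟘
  gaussBinomStep k (suc j) = X (suc k) ⊛ gaussBinom (suc k) j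

  gaussBinom-pascal : ∀ k j → gaussBinom (suc k) j ≈ gaussBinom k j ⊕ gaussBinomStep k j
  gaussBinom-pascal zero zero = ≈-sym (⊕-identityʳ 𝟙)
  gaussBinom-pascal (suc k) zero = ≈-sym (⊕-identityʳ 𝟙)
  gaussBinom-pascal k (suc j) = ≈-refl

  qBinomialTerm : ℕ → ℕ → ℕ → Series
  qBinomialTerm c k j = X (c * k + tri k) ⊛ gaussBinom k j

  qBinomialTerm-zero : ∀ c j → qBinomialTerm c 0 j ≈ 𝟙
  qBinomialTerm-zero c j = ≈-trans (⊛-cong (X-cong (trans (+-identityʳ (c * 0)) (*-zeroʳ c))) ≈-refl)
                                   (⊛-identityʳ 𝟙)

  private
    exponent-shift : ∀ c k → c * suc k + tri (suc k) ≡ suc c + (suc c * k + tri k)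
    exponent-shift c k = solveℕ 3 (λ c k t → c :* (con 1 :+ k) :+ ((con 1 :+ k) :+ t)
                                          := (con 1 :+ c) :+ ((con 1 :+ c) :* k :+ t)) refl c k (tri k)

    exponent-step : ∀ c k → c * suc k + tri (suc k) + suc k ≡ suc c * suc k + tri (suc k)
    exponent-step c k = solveℕ 3 (λ c k t → c :* (con 1 :+ k) :+ ((con 1 :+ k) :+ t) :+ (con 1 :+ k)
                                         := (con 1 :+ c) :* (con 1 :+ k) :+ ((con 1 :+ k) :+ t)) refl c k (tri k)

    qBinomial-reindex : ∀ c L →
      qBinomialTerm c 0 (suc L) ⊕ antidiagSum L (λ k j → X (c * suc k + tri (suc k)) ⊛ gaussBinomStep k j)
        ≈ antidiagSum L (qBinomialTerm (suc c))
    qBinomial-reindex c zero = begin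
      qBinomialTerm c 0 1 ⊕ X (c * 1 + 1) ⊛ 𝟘 ≈⟨ ⊕-cong (qBinomialTerm-zero c 1) (⊛-zeroʳ _) ⟩
      𝟙 ⊕ 𝟘                                    ≈⟨ ⊕-identityʳ 𝟙 ⟩
      𝟙                                        ≈⟨ qBinomialTerm-zero (suc c) 0 ⟨
      qBinomialTerm (suc c) 0 0                ∎
    qBinomial-reindex c (suc L) = begin
      qBinomialTerm c 0 (suc (suc L)) ⊕
        antidiagSum (suc L) (λ k j → X (c * suc k + tri (suc k)) ⊛ gaussBinomStep k j)
        ≈⟨ ⊕-cong (qBinomialTerm-zero c (suc (suc L)))
                  (antidiagSum-suc-last L (λ k j → X (c * suc k + tri (suc k)) ⊛ gaussBinomStep k j)) ⟩
      𝟙 ⊕ (antidiagSum L (λ k j → X (c * suc k + tri (suc k)) ⊛ (X (suc k) ⊛ gaussBinom (suc k) j)) ⊕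
             X (c * suc (suc L) + tri (suc (suc L))) ⊛ 𝟘)
        ≈⟨ ⊕-cong ≈-refl (≈-trans (⊕-cong ≈-refl (⊛-zeroʳ _)) (⊕-identityʳ _)) ⟩
      𝟙 ⊕ antidiagSum L (λ k j → X (c * suc k + tri (suc k)) ⊛ (X (suc k) ⊛ gaussBinom (suc k) j))
        ≈⟨ ⊕-cong (≈-sym (qBinomialTerm-zero (suc c) (suc L)))
                  (antidiagSum-cong-on L (λ k j _ →
                     ≈-trans (X⊛X⊛ _ _ _) (⊛-cong (X-cong (exponent-step c k)) ≈-refl))) ⟩
      qBinomialTerm (suc c) 0 (suc L) ⊕ antidiagSum L (λ k j → qBinomialTerm (suc c) (suc k) j)
        ≈⟨ antidiagSum-suc L (qBinomialTerm (suc c)) ⟨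
      antidiagSum (suc L) (qBinomialTerm (suc c)) ∎

  qBinomial : ∀ L c → eulerProdFrom c L ≈ antidiagSum L (qBinomialTerm c)
  qBinomial zero c = ≈-sym (qBinomialTerm-zero c 0)
  qBinomial (suc L) c = begin
    factor (suc c) ⊛ eulerProdFrom (suc c) L
      ≈⟨ ⊛-cong ≈-refl (qBinomial L (suc c)) ⟩
    factor (suc c) ⊛ Σ₁
      ≈⟨ factor⊛ (suc c) Σ₁ ⟩
    Σ₁ ⊕ X (suc c) ⊛ Σ₁
      ≈⟨ ⊕-cong (≈-sym (qBinomial-reindex c L)) (⊛-antidiagSum (X (suc c)) L (qBinomialTerm (suc c))) ⟩
    (qBinomialTerm c 0 (suc L) ⊕ Σₓ) ⊕ antidiagSum L (λ k j → X (suc c) ⊛ qBinomialTerm (suc c) k j)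
      ≈⟨ ≈-trans (⊕-assoc _ _ _) (⊕-cong ≈-refl (⊕-comm _ _)) ⟩
    qBinomialTerm c 0 (suc L) ⊕ (antidiagSum L (λ k j → X (suc c) ⊛ qBinomialTerm (suc c) k j) ⊕ Σₓ)
      ≈⟨ ⊕-cong ≈-refl (≈-trans (≈-sym (antidiagSum-⊕ L _ _)) (antidiagSum-cong-on L (λ k j _ → term k j))) ⟩
    qBinomialTerm c 0 (suc L) ⊕ antidiagSum L (λ k j → qBinomialTerm c (suc k) j)
      ≈⟨ antidiagSum-suc L (qBinomialTerm c) ⟨
    antidiagSum (suc L) (qBinomialTerm c) ∎
    where
    Σ₁ = antidiagSum L (qBinomialTerm (suc c))
    Σₓ = antidiagSum L (λ k j → X (c * suc k + tri (suc k)) ⊛ gaussBinomStep k j)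
    term : ∀ k j → X (suc c) ⊛ qBinomialTerm (suc c) k j ⊕ X (c * suc k + tri (suc k)) ⊛ gaussBinomStep k j
                   ≈ qBinomialTerm c (suc k) j
    term k j = begin
      X (suc c) ⊛ (X (suc c * k + tri k) ⊛ gaussBinom k j) ⊕ X e ⊛ gaussBinomStep k j
        ≈⟨ ⊕-cong (≈-trans (X⊛X⊛ _ _ _) (⊛-cong (X-cong (sym (exponent-shift c k))) ≈-refl)) ≈-refl ⟩
      X e ⊛ gaussBinom k j ⊕ X e ⊛ gaussBinomStep k j
        ≈⟨ ⊛-distribˡ-⊕ _ _ _ ⟨
      X e ⊛ (gaussBinom k j ⊕ gaussBinomStep k j)
        ≈⟨ ⊛-cong ≈-refl (gaussBinom-pascal k j) ⟨
      qBinomialTerm c (suc k) j ∎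
      where e = c * suc k + tri (suc k)

module Frobenius where

  open import Data.Nat using (zero; suc; _+_)
  open import Data.Bool using (false; _∧_)
  open import Data.Bool.Properties using (∧-comm; ∧-idem)
  open import Relation.Binary.PropositionalEquality using (_≡_; trans)
  open Antidiagonal
  open Series
  open import Algebra.Solver.CommutativeMonoid ⊛-commutativeMonoid
    using (solve; _⊜_) renaming (_⊕_ to _⊗_)
  open import Relation.Binary.Reasoning.Setoid Series-setoid

  sq : Series → Series
  sq f = f ⊛ f

  sq-cong : ∀ {a b} → a ≈ b → sq a ≈ sq b
  sq-cong e = ⊛-cong e e

  sq-⊕ : ∀ a b → sq (a ⊕ b) ≈ sq a ⊕ sq b
  sq-⊕ a b = begin
    (a ⊕ b) ⊛ (a ⊕ b)                  ≈⟨ ⊛-distribʳ-⊕ (a ⊕ b) a b ⟩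
    a ⊛ (a ⊕ b) ⊕ b ⊛ (a ⊕ b)          ≈⟨ ⊕-cong (⊛-distribˡ-⊕ a a b) (⊛-distribˡ-⊕ b a b) ⟩
    (a ⊛ a ⊕ a ⊛ b) ⊕ (b ⊛ a ⊕ b ⊛ b)  ≈⟨ ⊕-cong ≈-refl (⊕-cong (⊛-comm b a) ≈-refl) ⟩
    (a ⊛ a ⊕ a ⊛ b) ⊕ (a ⊛ b ⊕ b ⊛ b)  ≈⟨ ⊕-cancel-middle _ _ _ ⟩
    a ⊛ a ⊕ b ⊛ b                      ∎

  sq-⊛ : ∀ a b → sq (a ⊛ b) ≈ sq a ⊛ sq b
  sq-⊛ = solve 2 (λ a b → (a ⊗ b) ⊗ (a ⊗ b) ⊜ (a ⊗ a) ⊗ (b ⊗ b)) ≈-refl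

  sq-antidiagSum : ∀ M F → sq (antidiagSum M F) ≈ antidiagSum M (λ k j → sq (F k j))
  sq-antidiagSum zero F = ≈-refl
  sq-antidiagSum (suc M) F = begin
    sq (antidiagSum (suc M) F)
      ≈⟨ sq-cong (antidiagSum-suc M F) ⟩
    sq (F 0 (suc M) ⊕ antidiagSum M (λ k j → F (suc k) j))
      ≈⟨ sq-⊕ _ _ ⟩
    sq (F 0 (suc M)) ⊕ sq (antidiagSum M (λ k j → F (suc k) j))
      ≈⟨ ⊕-cong ≈-refl (sq-antidiagSum M (λ k j → F (suc k) j)) ⟩
    sq (F 0 (suc M)) ⊕ antidiagSum M (λ k j → sq (F (suc k) j))
      ≈⟨ antidiagSum-suc M (λ k j → sq (F k j)) ⟨
    antidiagSum (suc M) (λ k j → sq (F k j)) ∎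

  sq-coeff-even : ∀ f n → sq f (n + n) ≡ f n
  sq-coeff-even f n = trans (⊛-coeff f f (n + n))
    (trans (antidiag-symmetric-even n (λ i j → f i ∧ f j) (λ i j → ∧-comm (f i) (f j))) (∧-idem (f n)))

  sq-coeff-odd : ∀ f n → sq f (suc (n + n)) ≡ false
  sq-coeff-odd f n = trans (⊛-coeff f f (suc (n + n)))
    (antidiag-symmetric-odd n (λ i j → f i ∧ f j) (λ i j → ∧-comm (f i) (f j)))

module Jacobi where

  open import Data.Nat using (ℕ; zero; suc; _+_; _*_; _≤_; _<_; z≤n; s≤s; _≤?_)
  open import Data.Nat.Properties
  open import Data.Nat.Solver using (module +-*-Solver)
  open import Relation.Nullary using (yes; no)
  open import Relation.Binary.PropositionalEquality
    using (_≡_; refl; sym; trans; cong; subst)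
  open Series
  open QBinomial
  open Frobenius
  open import Algebra.Solver.CommutativeMonoid ⊛-commutativeMonoid
    using (solve; _⊜_) renaming (_⊕_ to _⊗_)
  open import Relation.Binary.Reasoning.Setoid Series-setoid
  open +-*-Solver using (_:=_; _:+_; _:*_; con) renaming (solve to solveℕ)

  tri-+ : ∀ a b → tri (a + b) ≡ tri a + a * b + tri b
  tri-+ zero b = refl
  tri-+ (suc a) b = trans (cong (suc (a + b) +_) (tri-+ a b))
    (solveℕ 5 (λ a b ta ab tb → (con 1 :+ (a :+ b)) :+ (ta :+ ab :+ tb)
                               := (con 1 :+ a :+ ta) :+ (b :+ ab) :+ tb) refl a b (tri a) (a * b) (tri b))

  tri-≥ : ∀ k → k ≤ tri k
  tri-≥ zero = z≤n
  tri-≥ (suc k) = m≤m+n (suc k) (tri k)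

  eulerProdFrom-zero : ∀ m → eulerProdFrom 0 m ≈ eulerProd m
  eulerProdFrom-zero m = ≈-sym (≈-trans (eulerProd-+ 0 m) (⊛-identityˡ (eulerProdFrom 0 m)))

  eulerProd-qBinomial : ∀ M → eulerProd M ≈ antidiagSum M (qBinomialTerm 0)
  eulerProd-qBinomial M = ≈-trans (≈-sym (eulerProdFrom-zero M)) (qBinomial M 0)

  ψ : ℕ → Series
  ψ M = antidiagSum M (λ m _ → X (tri m))

  -- Expand ∏(1 + qⁱ) by the q-binomial theorem, merge the two Gaussian binomials by the
  -- trinomial identity and resum the resulting triple sum along the other diagonal.
  jacobi-resummation : ∀ M →
    antidiagSum M (λ n r → X (tri n + tri n) ⊛ (gaussBinom n r ⊛ eulerProdFrom n r)) ≈
    antidiagSum M (λ m j → X (tri m) ⊛ eulerProdFrom j m)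
  jacobi-resummation M = begin
    antidiagSum M (λ n r → X (tri n + tri n) ⊛ (gaussBinom n r ⊛ eulerProdFrom n r))
      ≈⟨ antidiagSum-cong-on M (λ n r _ → expand n r) ⟩
    antidiagSum M (λ n r → antidiagSum r (λ k j → H n k j))
      ≈⟨ antidiagSum-assoc M H ⟩
    antidiagSum M (λ m j → antidiagSum m (λ n k → H n k j))
      ≈⟨ antidiagSum-cong-on M (λ m j _ → collapse m j) ⟩
    antidiagSum M (λ m j → X (tri m) ⊛ eulerProdFrom j m) ∎
    where
    H : ℕ → ℕ → ℕ → Series
    H n k j = X (tri (n + k)) ⊛ (gaussBinom (n + k) j ⊛ qBinomialTerm 0 n k)

    exponent : ∀ n k → (tri n + tri n) + (n * k + tri k) ≡ tri (n + k) + tri n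
    exponent n k = trans (solveℕ 3 (λ tn nk tk → (tn :+ tn) :+ (nk :+ tk) := (tn :+ nk :+ tk) :+ tn)
                                   refl (tri n) (n * k) (tri k))
                         (cong (_+ tri n) (sym (tri-+ n k)))

    expand-term : ∀ n k j → X (tri n + tri n) ⊛ (gaussBinom n (k + j) ⊛ qBinomialTerm n k j) ≈ H n k j
    expand-term n k j = begin
      X (tri n + tri n) ⊛ (gaussBinom n (k + j) ⊛ (X (n * k + tri k) ⊛ gaussBinom k j))
        ≈⟨ regroup₁ _ _ _ _ ⟩
      (X (tri n + tri n) ⊛ X (n * k + tri k)) ⊛ (gaussBinom n (k + j) ⊛ gaussBinom k j)
        ≈⟨ ⊛-cong (≈-trans (X⊛X _ _) (X-cong (exponent n k))) (gaussBinom-trinomial n k j) ⟩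
      X (tri (n + k) + tri n) ⊛ (gaussBinom (n + k) j ⊛ gaussBinom n k)
        ≈⟨ ⊛-cong (≈-sym (X⊛X (tri (n + k)) (tri n))) ≈-refl ⟩
      (X (tri (n + k)) ⊛ X (tri n)) ⊛ (gaussBinom (n + k) j ⊛ gaussBinom n k)
        ≈⟨ regroup₂ _ _ _ _ ⟩
      H n k j ∎
      where
      regroup₁ : ∀ a b c d → a ⊛ (b ⊛ (c ⊛ d)) ≈ (a ⊛ c) ⊛ (b ⊛ d)
      regroup₁ = solve 4 (λ a b c d → a ⊗ (b ⊗ (c ⊗ d)) ⊜ (a ⊗ c) ⊗ (b ⊗ d)) ≈-refl
      regroup₂ : ∀ a b c d → (a ⊛ b) ⊛ (c ⊛ d) ≈ a ⊛ (c ⊛ (b ⊛ d))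
      regroup₂ = solve 4 (λ a b c d → (a ⊗ b) ⊗ (c ⊗ d) ⊜ a ⊗ (c ⊗ (b ⊗ d))) ≈-refl

    expand : ∀ n r → X (tri n + tri n) ⊛ (gaussBinom n r ⊛ eulerProdFrom n r) ≈
                     antidiagSum r (λ k j → H n k j)
    expand n r = begin
      X (tri n + tri n) ⊛ (gaussBinom n r ⊛ eulerProdFrom n r)
        ≈⟨ ⊛-cong ≈-refl (⊛-cong ≈-refl (qBinomial r n)) ⟩
      X (tri n + tri n) ⊛ (gaussBinom n r ⊛ antidiagSum r (qBinomialTerm n))
        ≈⟨ ⊛-cong ≈-refl (⊛-antidiagSum (gaussBinom n r) r (qBinomialTerm n)) ⟩
      X (tri n + tri n) ⊛ antidiagSum r (λ k j → gaussBinom n r ⊛ qBinomialTerm n k j)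
        ≈⟨ ⊛-antidiagSum (X (tri n + tri n)) r _ ⟩
      antidiagSum r (λ k j → X (tri n + tri n) ⊛ (gaussBinom n r ⊛ qBinomialTerm n k j))
        ≈⟨ antidiagSum-cong-on r (λ { k j refl → expand-term n k j }) ⟩
      antidiagSum r (λ k j → H n k j) ∎

    collapse : ∀ m j → antidiagSum m (λ n k → H n k j) ≈ X (tri m) ⊛ eulerProdFrom j m
    collapse m j = begin
      antidiagSum m (λ n k → H n k j)
        ≈⟨ antidiagSum-cong-on m (λ { n k refl → ≈-sym (⊛-assoc (X (tri m)) (gaussBinom m j) _) }) ⟩
      antidiagSum m (λ n k → (X (tri m) ⊛ gaussBinom m j) ⊛ qBinomialTerm 0 n k)
        ≈⟨ ⊛-antidiagSum (X (tri m) ⊛ gaussBinom m j) m (qBinomialTerm 0) ⟨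
      (X (tri m) ⊛ gaussBinom m j) ⊛ antidiagSum m (qBinomialTerm 0)
        ≈⟨ ⊛-cong ≈-refl (eulerProd-qBinomial m) ⟨
      (X (tri m) ⊛ gaussBinom m j) ⊛ eulerProd m
        ≈⟨ ⊛-assoc _ _ _ ⟩
      X (tri m) ⊛ (gaussBinom m j ⊛ eulerProd m)
        ≈⟨ ⊛-cong ≈-refl (gaussBinom-eulerProdˡ m j) ⟩
      X (tri m) ⊛ eulerProdFrom j m ∎

  factor-≈[]-𝟙 : ∀ a → factor (suc a) ≈[ a ] 𝟙
  factor-≈[]-𝟙 a = ≈[]-trans (⊕-cong-≈[] (≈[]-refl {𝟙})
    (≈[]-trans (≈⇒≈[] (≈-sym (⊛-identityʳ (X (suc a))))) (X⊛≈[]𝟘 (suc a) 𝟙 a ≤-refl)))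
    (≈⇒≈[] (⊕-identityʳ 𝟙))

  eulerProdFrom-≈[]-𝟙 : ∀ a L → eulerProdFrom a L ≈[ a ] 𝟙
  eulerProdFrom-≈[]-𝟙 a zero = ≈[]-refl
  eulerProdFrom-≈[]-𝟙 a (suc L) = ≈[]-trans
    (⊛-cong-≈[] (factor-≈[]-𝟙 a) (≈[]-mono (n≤1+n a) (eulerProdFrom-≈[]-𝟙 (suc a) L)))
    (≈⇒≈[] (⊛-identityˡ 𝟙))

  -- A term with m ≤ N has its partner index j ≥ N, so the product over (j, j + m] is 1 up to
  -- degree N; a term with m > N starts beyond degree N anyway.
  X⊛eulerProdFrom-≈[] : ∀ N M → N + N ≤ M → ∀ m j → m + j ≡ M → ∀ e → m ≤ e →
    ∀ f → X e ⊛ (f ⊛ eulerProdFrom j m) ≈[ N ] X e ⊛ f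
  X⊛eulerProdFrom-≈[] N M 2N≤M m j m+j≡M e m≤e f with m ≤? N
  ... | yes m≤N = ⊛-congˡ-≈[] (X e) (≈[]-trans
        (⊛-congˡ-≈[] f (≈[]-mono N≤j (eulerProdFrom-≈[]-𝟙 j m))) (≈⇒≈[] (⊛-identityʳ f)))
    where
    N≤j : N ≤ j
    N≤j = +-cancelˡ-≤ m N j (≤-trans (+-monoˡ-≤ N m≤N) (≤-trans 2N≤M (≤-reflexive (sym m+j≡M))))
  ... | no m≰N = ≈[]-trans (X⊛≈[]𝟘 e _ N N<e) (≈[]-sym (X⊛≈[]𝟘 e f N N<e))
    where
    N<e : N < e
    N<e = <-≤-trans (≰⇒> m≰N) m≤e

  cube-expansion : ∀ M → eulerProd M ⊛ sq (eulerProd M) ≈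
    antidiagSum M (λ k j → X (tri k + tri k) ⊛ ((gaussBinom k j ⊛ eulerProdFrom k j) ⊛ eulerProdFrom j k))
  cube-expansion M = begin
    eulerProd M ⊛ sq (eulerProd M)
      ≈⟨ ⊛-cong ≈-refl (≈-trans (sq-cong (eulerProd-qBinomial M)) (sq-antidiagSum M (qBinomialTerm 0))) ⟩
    eulerProd M ⊛ antidiagSum M (λ k j → sq (qBinomialTerm 0 k j))
      ≈⟨ ⊛-antidiagSum (eulerProd M) M _ ⟩
    antidiagSum M (λ k j → eulerProd M ⊛ sq (qBinomialTerm 0 k j))
      ≈⟨ antidiagSum-cong-on M (λ { k j refl → term k j }) ⟩
    antidiagSum M (λ k j → X (tri k + tri k) ⊛ ((gaussBinom k j ⊛ eulerProdFrom k j) ⊛ eulerProdFrom j k)) ∎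
    where
    term : ∀ k j → eulerProd (k + j) ⊛ sq (qBinomialTerm 0 k j) ≈
                   X (tri k + tri k) ⊛ ((gaussBinom k j ⊛ eulerProdFrom k j) ⊛ eulerProdFrom j k)
    term k j = begin
      eulerProd (k + j) ⊛ sq (X (tri k) ⊛ gaussBinom k j)
        ≈⟨ ⊛-cong (eulerProd-+ k j) (≈-trans (sq-⊛ (X (tri k)) _) (⊛-cong (X⊛X (tri k) (tri k)) ≈-refl)) ⟩
      (eulerProd k ⊛ eulerProdFrom k j) ⊛ (X (tri k + tri k) ⊛ sq (gaussBinom k j))
        ≈⟨ regroup _ _ _ _ ⟩
      X (tri k + tri k) ⊛ ((gaussBinom k j ⊛ eulerProdFrom k j) ⊛ (gaussBinom k j ⊛ eulerProd k))
        ≈⟨ ⊛-cong ≈-refl (⊛-cong ≈-refl (gaussBinom-eulerProdˡ k j)) ⟩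
      X (tri k + tri k) ⊛ ((gaussBinom k j ⊛ eulerProdFrom k j) ⊛ eulerProdFrom j k) ∎
      where
      regroup : ∀ e p x g → (e ⊛ p) ⊛ (x ⊛ (g ⊛ g)) ≈ x ⊛ ((g ⊛ p) ⊛ (g ⊛ e))
      regroup = solve 4 (λ e p x g → (e ⊗ p) ⊗ (x ⊗ (g ⊗ g)) ⊜ x ⊗ ((g ⊗ p) ⊗ (g ⊗ e))) ≈-refl

  jacobi-≈[] : ∀ N M → N + N ≤ M → eulerProd M ⊛ sq (eulerProd M) ≈[ N ] ψ M
  jacobi-≈[] N M 2N≤M =
    ≈[]-trans (≈⇒≈[] (cube-expansion M))
    (≈[]-trans (antidiagSum-cong-on-≈[] M (λ k j k+j≡M →
                 X⊛eulerProdFrom-≈[] N M 2N≤M k j k+j≡M _ (≤-trans (tri-≥ k) (m≤m+n _ _)) _))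
    (≈[]-trans (≈⇒≈[] (jacobi-resummation M))
               (antidiagSum-cong-on-≈[] M (λ m j m+j≡M → ≈[]-trans
                 (≈⇒≈[] (⊛-cong ≈-refl (≈-sym (⊛-identityˡ _))))
                 (≈[]-trans (X⊛eulerProdFrom-≈[] N M 2N≤M m j m+j≡M _ (tri-≥ m) 𝟙)
                            (≈⇒≈[] (⊛-identityʳ _)))))))

  eulerProd-≈[] : ∀ a d → eulerProd (a + d) ≈[ a ] eulerProd a
  eulerProd-≈[] a d = ≈[]-trans (≈⇒≈[] (eulerProd-+ a d))
    (≈[]-trans (⊛-congˡ-≈[] (eulerProd a) (eulerProdFrom-≈[]-𝟙 a d)) (≈⇒≈[] (⊛-identityʳ (eulerProd a))))

  ψ-suc : ∀ m → ψ (suc m) ≈ ψ m ⊕ X (tri (suc m))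
  ψ-suc m = antidiagSum-suc-last m (λ k _ → X (tri k))

  ψ-≈[] : ∀ N d → ψ (N + d) ≈[ N ] ψ N
  ψ-≈[] N zero = subst (λ z → ψ z ≈[ N ] ψ N) (sym (+-identityʳ N)) ≈[]-refl
  ψ-≈[] N (suc d) = subst (λ z → ψ z ≈[ N ] ψ N) (sym (+-suc N d))
    (≈[]-trans (≈⇒≈[] (ψ-suc (N + d)))
    (≈[]-trans (⊕-cong-≈[] (ψ-≈[] N d)
                           (≈[]-trans (≈⇒≈[] (≈-sym (⊛-identityʳ _))) (X⊛≈[]𝟘 _ 𝟙 N N<tri)))
               (≈⇒≈[] (⊕-identityʳ _))))
    where
    N<tri : N < tri (suc (N + d))
    N<tri = ≤-trans (s≤s (m≤m+n N d)) (tri-≥ (suc (N + d)))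

module Pentagonal where

  open import Data.Nat using (ℕ; zero; suc; _+_; _*_; _≤_; z≤n; s≤s)
  open import Data.Nat.Properties
  open import Data.Nat.Solver using (module +-*-Solver)
  open import Data.Bool using (true)
  open import Data.Product using (∃-syntax; _,_)
  open import Data.Sum using (inj₁; inj₂)
  open import Relation.Binary.PropositionalEquality
    using (_≡_; refl; sym; trans; cong; subst)
  open Series
  open QBinomial
  open import Algebra.Solver.CommutativeMonoid ⊛-commutativeMonoid
    using (solve; _⊜_) renaming (_⊕_ to _⊗_)
  open import Relation.Binary.Reasoning.Setoid Series-setoid
  open +-*-Solver using (_:=_; _:+_; _:*_; con) renaming (solve to solveℕ)

  -- Shanks' finite form of the pentagonal number theorem:
  -- S n = Σ_{k+j=n} q^{nk + T k} ∏_{k<i≤n} (1 + qⁱ) agrees with ∏_{i≤n} (1 + qⁱ) below degree n + 1,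
  -- and S (n + 1) - S n consists of two pentagonal monomials.
  shanksTerm : ℕ → ℕ → Series
  shanksTerm k j = X ((k + j) * k + tri k) ⊛ eulerProdFrom k j

  shanksSum : ℕ → Series
  shanksSum n = antidiagSum n shanksTerm

  pentagonal₁ pentagonal₂ : ℕ → ℕ
  pentagonal₁ n = suc (n + n) + (n * n + tri n)
  pentagonal₂ n = suc n * suc n + tri (suc n)

  pentagonalSum : ℕ → Series
  pentagonalSum zero = 𝟙
  pentagonalSum (suc n) = pentagonalSum n ⊕ X (pentagonal₁ n) ⊕ X (pentagonal₂ n)

  shanksTerm-suc : ∀ n k j → k + j ≡ n → shanksTerm k (suc j) ≈ (X k ⊛ shanksTerm k j) ⊛ factor (suc n)
  shanksTerm-suc n k j refl = begin
    X ((k + suc j) * k + tri k) ⊛ eulerProdFrom k (suc j)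
      ≈⟨ ⊛-cong (X-cong exponent) (eulerProdFrom-suc-last k j) ⟩
    X (k + ((k + j) * k + tri k)) ⊛ (eulerProdFrom k j ⊛ factor (suc (k + j)))
      ≈⟨ ⊛-cong (≈-sym (X⊛X k _)) ≈-refl ⟩
    (X k ⊛ X ((k + j) * k + tri k)) ⊛ (eulerProdFrom k j ⊛ factor (suc (k + j)))
      ≈⟨ regroup _ _ _ _ ⟩
    (X k ⊛ (X ((k + j) * k + tri k) ⊛ eulerProdFrom k j)) ⊛ factor (suc (k + j)) ∎
    where
    exponent : (k + suc j) * k + tri k ≡ k + ((k + j) * k + tri k)
    exponent = trans (cong (λ z → z * k + tri k) (+-suc k j)) (+-assoc k ((k + j) * k) (tri k))
    regroup : ∀ a c d e → (a ⊛ c) ⊛ (d ⊛ e) ≈ (a ⊛ (c ⊛ d)) ⊛ e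
    regroup = solve 4 (λ a c d e → (a ⊗ c) ⊗ (d ⊗ e) ⊜ (a ⊗ (c ⊗ d)) ⊗ e) ≈-refl

  shanksDefect : ℕ → ℕ → ℕ → Series
  shanksDefect n zero j = 𝟘
  shanksDefect n (suc k) j = X (n + suc k) ⊛ shanksTerm k (suc j)

  X⊛shanksTerm : ∀ n k j → k + j ≡ n → X k ⊛ shanksTerm k j ≈ shanksTerm k j ⊕ shanksDefect n k j
  X⊛shanksTerm n zero j e = ≈-trans (⊛-identityˡ _) (≈-sym (⊕-identityʳ _))
  X⊛shanksTerm n (suc k) j refl = begin
    X (suc k) ⊛ t                         ≈⟨ ⊕-cancelˡ t (X (suc k) ⊛ t) ⟨
    t ⊕ (t ⊕ X (suc k) ⊛ t)               ≈⟨ ⊕-cong ≈-refl (≈-sym (factor⊛ (suc k) t)) ⟩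
    t ⊕ factor (suc k) ⊛ (α ⊛ P)          ≈⟨ ⊕-cong ≈-refl (rotate (factor (suc k)) α P) ⟩
    t ⊕ α ⊛ eulerProdFrom k (suc j)       ≈⟨ ⊕-cong ≈-refl (⊛-cong (X-cong (sym exponent)) ≈-refl) ⟩
    t ⊕ X (suc k + j + suc k + e) ⊛ eulerProdFrom k (suc j)
                                          ≈⟨ ⊕-cong ≈-refl (≈-sym (X⊛X⊛ _ _ _)) ⟩
    t ⊕ X (suc k + j + suc k) ⊛ shanksTerm k (suc j) ∎
    where
    α = X ((suc k + j) * suc k + tri (suc k))
    P = eulerProdFrom (suc k) j
    t = α ⊛ P
    e = (k + suc j) * k + tri k
    exponent : suc k + j + suc k + e ≡ (suc k + j) * suc k + tri (suc k)
    exponent = trans (cong (λ z → suc k + j + suc k + (z * k + tri k)) (+-suc k j))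
      (solveℕ 3 (λ k j t → (con 1 :+ k :+ j) :+ (con 1 :+ k) :+ ((con 1 :+ (k :+ j)) :* k :+ t)
                         := (con 1 :+ k :+ j) :* (con 1 :+ k) :+ ((con 1 :+ k) :+ t)) refl k j (tri k))
    rotate : ∀ f a p → f ⊛ (a ⊛ p) ≈ a ⊛ (f ⊛ p)
    rotate = solve 3 (λ f a p → f ⊗ (a ⊗ p) ⊜ a ⊗ (f ⊗ p)) ≈-refl

  shanksShifted : ℕ → Series
  shanksShifted n = antidiagSum n (λ k j → X k ⊛ shanksTerm k j)

  shanksShifted-split : ∀ n → shanksShifted n ≈ shanksSum n ⊕ antidiagSum n (shanksDefect n)
  shanksShifted-split n = ≈-trans (antidiagSum-cong-on n (X⊛shanksTerm n))
                                  (antidiagSum-⊕ n shanksTerm (shanksDefect n))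

  shanksDefect-sum : ∀ n → antidiagSum n (shanksDefect n) ≈
                           X (suc n) ⊛ shanksShifted n ⊕ X (suc (n + n)) ⊛ shanksTerm n 0
  shanksDefect-sum zero = begin
    𝟘
      ≈⟨ ⊕-self _ ⟨
    X 1 ⊛ shanksTerm 0 0 ⊕ X 1 ⊛ shanksTerm 0 0
      ≈⟨ ⊕-cong (⊛-cong ≈-refl (≈-sym (⊛-identityˡ _))) ≈-refl ⟩
    X 1 ⊛ shanksShifted 0 ⊕ X 1 ⊛ shanksTerm 0 0 ∎
  shanksDefect-sum (suc n′) = ⊕-move (begin
    X (suc n) ⊛ shanksShifted n
      ≈⟨ ⊛-antidiagSum (X (suc n)) n (λ k j → X k ⊛ shanksTerm k j) ⟩
    antidiagSum n (λ k j → X (suc n) ⊛ (X k ⊛ shanksTerm k j))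
      ≈⟨ antidiagSum-suc-last n′ (λ k j → X (suc n) ⊛ (X k ⊛ shanksTerm k j)) ⟩
    antidiagSum n′ (λ k j → X (suc n) ⊛ (X k ⊛ shanksTerm k (suc j))) ⊕ X (suc n) ⊛ (X n ⊛ shanksTerm n 0)
      ≈⟨ ⊕-cong (antidiagSum-cong-on n′ (λ k j _ →
                   ≈-trans (X⊛X⊛ _ _ _) (⊛-cong (X-cong (sym (+-suc n k))) ≈-refl)))
                (X⊛X⊛ _ _ _) ⟩
    antidiagSum n′ (λ k j → X (n + suc k) ⊛ shanksTerm k (suc j)) ⊕ X (suc (n + n)) ⊛ shanksTerm n 0
      ≈⟨ ⊕-cong (≈-sym (≈-trans (antidiagSum-suc n′ (shanksDefect n)) (⊕-identityˡ _))) ≈-refl ⟩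
    antidiagSum n (shanksDefect n) ⊕ X (suc (n + n)) ⊛ shanksTerm n 0 ∎)
    where
    n = suc n′

  shanksSum-suc : ∀ n → shanksSum (suc n) ≈ shanksSum n ⊕ X (pentagonal₁ n) ⊕ X (pentagonal₂ n)
  shanksSum-suc n = begin
    antidiagSum (suc n) shanksTerm
      ≈⟨ antidiagSum-suc-last n shanksTerm ⟩
    antidiagSum n (λ k j → shanksTerm k (suc j)) ⊕ shanksTerm (suc n) 0
      ≈⟨ ⊕-cong (antidiagSum-cong-on n (λ k j e → ≈-trans (shanksTerm-suc n k j e) (⊛-comm _ _))) ≈-refl ⟩
    antidiagSum n (λ k j → factor (suc n) ⊛ (X k ⊛ shanksTerm k j)) ⊕ shanksTerm (suc n) 0
      ≈⟨ ⊕-cong (≈-trans (≈-sym (⊛-antidiagSum (factor (suc n)) n _)) (factor⊛ (suc n) _)) ≈-refl ⟩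
    (shanksShifted n ⊕ X (suc n) ⊛ shanksShifted n) ⊕ shanksTerm (suc n) 0
      ≈⟨ ⊕-cong (⊕-cong (≈-trans (shanksShifted-split n) (⊕-cong ≈-refl (shanksDefect-sum n))) ≈-refl)
                ≈-refl ⟩
    ((shanksSum n ⊕ (X (suc n) ⊛ shanksShifted n ⊕ Y)) ⊕ X (suc n) ⊛ shanksShifted n) ⊕ shanksTerm (suc n) 0
      ≈⟨ ⊕-cong (cancel-middle (shanksSum n) (X (suc n) ⊛ shanksShifted n) Y) ≈-refl ⟩
    (shanksSum n ⊕ Y) ⊕ shanksTerm (suc n) 0
      ≈⟨ ⊕-cong (⊕-cong ≈-refl Y≈X) last≈X ⟩
    shanksSum n ⊕ X (pentagonal₁ n) ⊕ X (pentagonal₂ n) ∎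
    where
    Y = X (suc (n + n)) ⊛ shanksTerm n 0
    cancel-middle : ∀ s u y → (s ⊕ (u ⊕ y)) ⊕ u ≈ s ⊕ y
    cancel-middle s u y = ≈-trans (⊕-assoc _ _ _) (⊕-cong ≈-refl (≈-trans (⊕-comm _ _) (⊕-cancelˡ u y)))
    Y≈X : Y ≈ X (pentagonal₁ n)
    Y≈X = ≈-trans (⊛-cong ≈-refl (⊛-identityʳ _))
      (≈-trans (X⊛X _ _) (X-cong (cong (λ z → suc (n + n) + (z * n + tri n)) (+-identityʳ n))))
    last≈X : shanksTerm (suc n) 0 ≈ X (pentagonal₂ n)
    last≈X = ≈-trans (⊛-identityʳ _) (X-cong (cong (λ z → z * suc n + tri (suc n)) (+-identityʳ (suc n))))

  shanksSum≈pentagonalSum : ∀ n → shanksSum n ≈ pentagonalSum n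
  shanksSum≈pentagonalSum zero = ⊛-identityʳ _
  shanksSum≈pentagonalSum (suc n) =
    ≈-trans (shanksSum-suc n) (⊕-cong (⊕-cong (shanksSum≈pentagonalSum n) ≈-refl) ≈-refl)

  shanksTerm-≈[]-𝟘 : ∀ k j → shanksTerm (suc k) j ≈[ suc k + j ] 𝟘
  shanksTerm-≈[]-𝟘 k j = X⊛≈[]𝟘 _ _ _
    (subst (_≤ (suc k + j) * suc k + tri (suc k)) (+-comm (suc k + j) 1)
           (+-mono-≤ (m≤m*n (suc k + j) (suc k)) (s≤s z≤n)))

  shanksSum-≈[]-eulerProd : ∀ n → shanksSum n ≈[ n ] eulerProd n
  shanksSum-≈[]-eulerProd zero = ≈⇒≈[] (⊛-identityʳ _)
  shanksSum-≈[]-eulerProd (suc n) =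
    ≈[]-trans (≈⇒≈[] (antidiagSum-suc n shanksTerm))
    (≈[]-trans (⊕-cong-≈[] (≈⇒≈[] first≈eulerProd)
                           (≈[]-trans (antidiagSum-cong-on-≈[] n (λ { k j refl → shanksTerm-≈[]-𝟘 k j }))
                                      (≈⇒≈[] (antidiagSum-𝟘 n))))
               (≈⇒≈[] (⊕-identityʳ _)))
    where
    first≈eulerProd : shanksTerm 0 (suc n) ≈ eulerProd (suc n)
    first≈eulerProd = ≈-trans (⊛-cong (X-cong (trans (+-identityʳ _) (*-zeroʳ (suc n)))) ≈-refl)
      (≈-trans (⊛-identityˡ _) (≈-trans (≈-sym (⊛-identityˡ _)) (≈-sym (eulerProd-+ 0 (suc n)))))

  tri-double : ∀ i → tri i + tri i ≡ i * suc i
  tri-double zero = refl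
  tri-double (suc i) =
    trans (solveℕ 2 (λ i t → ((con 1 :+ i) :+ t) :+ ((con 1 :+ i) :+ t) := (con 2 :+ i :+ i) :+ (t :+ t))
                    refl i (tri i))
    (trans (cong (2 + i + i +_) (tri-double i))
           (solveℕ 1 (λ i → con 2 :+ i :+ i :+ i :* (con 1 :+ i) := (con 1 :+ i) :* (con 2 :+ i)) refl i))

  pentagonal₁-square : ∀ i → 24 * pentagonal₁ i + 1 ≡ (6 * i + 5) * (6 * i + 5)
  pentagonal₁-square i =
    trans (solveℕ 2 (λ i t → con 24 :* ((con 1 :+ (i :+ i)) :+ (i :* i :+ t)) :+ con 1
                           := con 25 :+ con 48 :* i :+ con 24 :* (i :* i) :+ con 12 :* (t :+ t)) refl i (tri i))
    (trans (cong (λ z → 25 + 48 * i + 24 * (i * i) + 12 * z) (tri-double i))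
           (solveℕ 1 (λ i → con 25 :+ con 48 :* i :+ con 24 :* (i :* i) :+ con 12 :* (i :* (con 1 :+ i))
                          := (con 6 :* i :+ con 5) :* (con 6 :* i :+ con 5)) refl i))

  pentagonal₂-square : ∀ i → 24 * pentagonal₂ i + 1 ≡ (6 * i + 7) * (6 * i + 7)
  pentagonal₂-square i =
    trans (solveℕ 2 (λ i t → con 24 :* ((con 1 :+ i) :* (con 1 :+ i) :+ ((con 1 :+ i) :+ t)) :+ con 1
                           := con 49 :+ con 72 :* i :+ con 24 :* (i :* i) :+ con 12 :* (t :+ t)) refl i (tri i))
    (trans (cong (λ z → 49 + 72 * i + 24 * (i * i) + 12 * z) (tri-double i))
           (solveℕ 1 (λ i → con 49 :+ con 72 :* i :+ con 24 :* (i :* i) :+ con 12 :* (i :* (con 1 :+ i))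
                          := (con 6 :* i :+ con 7) :* (con 6 :* i :+ con 7)) refl i))

  pentagonalSum-support : ∀ n m → pentagonalSum n m ≡ true → ∃[ s ] 24 * m + 1 ≡ s * s
  pentagonalSum-support zero m e = 1 , cong (λ z → 24 * z + 1) (X-coeff-true 0 m e)
  pentagonalSum-support (suc n) m e with ⊕-coeff-true (pentagonalSum n ⊕ X (pentagonal₁ n)) _ m e
  ... | inj₂ e₂ = 6 * n + 7 , trans (cong (λ z → 24 * z + 1) (X-coeff-true _ m e₂)) (pentagonal₂-square n)
  ... | inj₁ e′ with ⊕-coeff-true (pentagonalSum n) (X (pentagonal₁ n)) m e′
  ...   | inj₁ e₀ = pentagonalSum-support n m e₀
  ...   | inj₂ e₁ = 6 * n + 5 , trans (cong (λ z → 24 * z + 1) (X-coeff-true _ m e₁)) (pentagonal₁-square n)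

  eulerProd-support : ∀ h → eulerProd h h ≡ true → ∃[ s ] 24 * h + 1 ≡ s * s
  eulerProd-support h e = pentagonalSum-support h h
    (trans (sym (coeff (shanksSum≈pentagonalSum h) h))
           (trans (coeff≤ (shanksSum-≈[]-eulerProd h) h ≤-refl) e))

module SquareCriterion where

  open import Data.Nat using (zero; suc; _+_; _*_)
  open import Data.Nat.Properties using (≤-refl; +-suc)
  open import Data.Nat.Solver using (module +-*-Solver)
  open import Data.Bool using (true)
  open import Data.Product using (∃-syntax; _,_)
  open import Data.Sum using (_⊎_; inj₁; inj₂)
  open import Relation.Nullary using (contradiction)
  open import Relation.Binary.PropositionalEquality
  open Series
  open QBinomial
  open Frobenius
  open Jacobi
  open Pentagonal
  open +-*-Solver using (_:=_; _:*_; _:+_; con) renaming (solve to solveℕ)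

  even-or-odd : ∀ n → ∃[ h ] (n ≡ h + h ⊎ n ≡ suc (h + h))
  even-or-odd zero = 0 , inj₁ refl
  even-or-odd (suc n) with even-or-odd n
  ... | h , inj₁ refl = h , inj₂ refl
  ... | h , inj₂ refl = suc h , inj₁ (cong suc (sym (+-suc h h)))

  -- Jacobi's identity E³ ≡ ψ (mod 2) lets us cancel E from E A ≡ ψ below degree N.
  sq-eulerProd-coeff : ∀ N A → eulerProd N ⊛ A ≈ ψ N → sq (eulerProd N) N ≡ A N
  sq-eulerProd-coeff N A E⊛A≈ψ =
    coeff≤ (⊛-cancelˡ-≈[] (eulerProd N) (eulerProd-coeff-0 N) N E⊛E²≈E⊛A) N ≤-refl
    where
    E⊛E²≈E⊛A : eulerProd N ⊛ sq (eulerProd N) ≈[ N ] eulerProd N ⊛ A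
    E⊛E²≈E⊛A = ≈[]-trans
      (≈[]-sym (⊛-cong-≈[] (eulerProd-≈[] N N) (⊛-cong-≈[] (eulerProd-≈[] N N) (eulerProd-≈[] N N))))
      (≈[]-trans (jacobi-≈[] N (N + N) ≤-refl) (≈[]-trans (ψ-≈[] N N) (≈⇒≈[] (≈-sym E⊛A≈ψ))))

  sq-eulerProd-support : ∀ N → sq (eulerProd N) N ≡ true → ∃[ s ] 12 * N + 1 ≡ s * s
  sq-eulerProd-support N e with even-or-odd N
  ... | h , inj₂ refl = contradiction (trans (sym e) (sq-coeff-odd (eulerProd N) h)) λ ()
  ... | h , inj₁ refl with eulerProd-support h Eₕ-coeff
    where
    Eₕ-coeff : eulerProd h h ≡ true
    Eₕ-coeff = trans (sym (coeff≤ (eulerProd-≈[] h h) h ≤-refl))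
                     (trans (sym (sq-coeff-even (eulerProd (h + h)) h)) e)
  ...   | s , 24h+1≡s² = s , trans (cong (_+ 1) (solveℕ 1 (λ h → con 12 :* (h :+ h) := con 24 :* h) refl h)) 24h+1≡s²

module XorSum where

  open import Data.Nat using (ℕ; zero; suc; _+_; _≤_; _<_; z≤n; s≤s)
  open import Data.Bool using (Bool; true; false; _∧_; _xor_; not)
  open import Data.Bool.Properties using (not-involutive; xor-assoc; ∧-distribˡ-xor; ∧-zeroʳ; xor-∧-commutativeRing)
  open import Data.List using (List; []; _∷_; _++_; length; map; concatMap; filter; applyUpTo)
  open import Data.List.Relation.Unary.All using (All; []; _∷_)
  open import Algebra.Bundles using (CommutativeRing)
  open import Algebra.Properties.CommutativeSemigroup
    (CommutativeRing.+-commutativeSemigroup xor-∧-commutativeRing)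
    renaming (interchange to xor-interchange) using ()
  open import Relation.Nullary using (Dec; does; ¬_; contradiction)
  open import Data.Nat.Divisibility using (_∣_; divides)
  open import Relation.Binary.PropositionalEquality

  private variable A B : Set

  xorSum : (A → Bool) → List A → Bool
  xorSum f [] = false
  xorSum f (x ∷ xs) = f x xor xorSum f xs

  xorSum-++ : (f : A → Bool) → ∀ xs ys → xorSum f (xs ++ ys) ≡ xorSum f xs xor xorSum f ys
  xorSum-++ f [] ys = refl
  xorSum-++ f (x ∷ xs) ys = trans (cong (f x xor_) (xorSum-++ f xs ys)) (sym (xor-assoc (f x) _ _))

  xorSum-concatMap : (f : B → Bool) (g : A → List B) → ∀ xs →
                     xorSum f (concatMap g xs) ≡ xorSum (λ x → xorSum f (g x)) xs
  xorSum-concatMap f g [] = refl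
  xorSum-concatMap f g (x ∷ xs) =
    trans (xorSum-++ f (g x) (concatMap g xs)) (cong (xorSum f (g x) xor_) (xorSum-concatMap f g xs))

  xorSum-map : (f : B → Bool) (g : A → B) → ∀ xs → xorSum f (map g xs) ≡ xorSum (λ x → f (g x)) xs
  xorSum-map f g [] = refl
  xorSum-map f g (x ∷ xs) = cong (f (g x) xor_) (xorSum-map f g xs)

  xorSum-filter : {P : A → Set} (P? : ∀ x → Dec (P x)) (f : A → Bool) → ∀ xs →
                  xorSum f (filter P? xs) ≡ xorSum (λ x → does (P? x) ∧ f x) xs
  xorSum-filter P? f [] = refl
  xorSum-filter P? f (x ∷ xs) with does (P? x)
  ... | true = cong (f x xor_) (xorSum-filter P? f xs)
  ... | false = xorSum-filter P? f xs

  xorSum-cong-All : {Q : A → Set} (f g : A → Bool) → ∀ {xs} → All Q xs → (∀ {x} → Q x → f x ≡ g x) →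
                    xorSum f xs ≡ xorSum g xs
  xorSum-cong-All f g [] e = refl
  xorSum-cong-All f g (q ∷ qs) e = cong₂ _xor_ (e q) (xorSum-cong-All f g qs e)

  xorSum-xor : (f g : A → Bool) → ∀ xs → xorSum (λ x → f x xor g x) xs ≡ xorSum f xs xor xorSum g xs
  xorSum-xor f g [] = refl
  xorSum-xor f g (x ∷ xs) =
    trans (cong ((f x xor g x) xor_) (xorSum-xor f g xs)) (xor-interchange (f x) (g x) _ _)

  xorSum-∧ˡ : (b : Bool) (f : A → Bool) → ∀ xs → xorSum (λ x → b ∧ f x) xs ≡ b ∧ xorSum f xs
  xorSum-∧ˡ b f [] = sym (∧-zeroʳ b)
  xorSum-∧ˡ b f (x ∷ xs) = trans (cong ((b ∧ f x) xor_) (xorSum-∧ˡ b f xs)) (sym (∧-distribˡ-xor b (f x) _))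

  isOdd-suc : ∀ n → isOdd (suc n) ≡ not (isOdd n)
  isOdd-suc n with isOdd n
  ... | true = refl
  ... | false = refl

  isOdd-suc-suc : ∀ n → isOdd (suc (suc n)) ≡ isOdd n
  isOdd-suc-suc n = trans (isOdd-suc (suc n)) (trans (cong not (isOdd-suc n)) (not-involutive (isOdd n)))

  isOdd≡false⇒2∣ : ∀ n → isOdd n ≡ false → 2 ∣ n
  isOdd≡false⇒2∣ zero _ = divides 0 refl
  isOdd≡false⇒2∣ (suc (suc n)) e with isOdd≡false⇒2∣ n (trans (sym (isOdd-suc-suc n)) e)
  ... | divides q n≡q*2 = divides (suc q) (cong (λ z → suc (suc z)) n≡q*2)

  2∤⇒isOdd : ∀ n → ¬ (2 ∣ n) → isOdd n ≡ true
  2∤⇒isOdd n 2∤n with isOdd n in eq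
  ... | true = refl
  ... | false = contradiction (isOdd≡false⇒2∣ n eq) 2∤n

  isOdd-length-filter : (f : A → Bool) → ∀ xs →
    isOdd (length (filter (λ x → f x Data.Bool.≟ true) xs)) ≡ xorSum f xs
  isOdd-length-filter f [] = refl
  isOdd-length-filter f (x ∷ xs) with f x
  ... | true = trans (isOdd-suc (length (filter (λ x → f x Data.Bool.≟ true) xs)))
                     (cong not (isOdd-length-filter f xs))
  ... | false = isOdd-length-filter f xs

  xorUpTo : ℕ → (ℕ → Bool) → Bool
  xorUpTo zero h = false
  xorUpTo (suc n) h = h 0 xor xorUpTo n (λ k → h (suc k))

  xorSum-applyUpTo : (f : ℕ → Bool) (g : ℕ → ℕ) → ∀ n → xorSum f (applyUpTo g n) ≡ xorUpTo n (λ k → f (g k))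
  xorSum-applyUpTo f g zero = refl
  xorSum-applyUpTo f g (suc n) = cong (f (g 0) xor_) (xorSum-applyUpTo f (λ k → g (suc k)) n)

  xorUpTo-cong-on : ∀ n {h h′} → (∀ k → k < n → h k ≡ h′ k) → xorUpTo n h ≡ xorUpTo n h′
  xorUpTo-cong-on zero e = refl
  xorUpTo-cong-on (suc n) e = cong₂ _xor_ (e 0 (s≤s z≤n)) (xorUpTo-cong-on n (λ k p → e (suc k) (s≤s p)))

  xorUpTo-false : ∀ n h → (∀ k → k < n → h k ≡ false) → xorUpTo n h ≡ false
  xorUpTo-false zero h e = refl
  xorUpTo-false (suc n) h e = cong₂ _xor_ (e 0 (s≤s z≤n)) (xorUpTo-false n _ (λ k p → e (suc k) (s≤s p)))

  xorUpTo-+ : ∀ a b h → (∀ k → a ≤ k → h k ≡ false) → xorUpTo (a + b) h ≡ xorUpTo a h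
  xorUpTo-+ zero b h e = xorUpTo-false b h (λ k _ → e k z≤n)
  xorUpTo-+ (suc a) b h e = cong (h 0 xor_) (xorUpTo-+ a b (λ k → h (suc k)) (λ k p → e (suc k) (s≤s p)))

  xorUpTo-xor : ∀ n h h′ → xorUpTo n (λ k → h k xor h′ k) ≡ xorUpTo n h xor xorUpTo n h′
  xorUpTo-xor zero h h′ = refl
  xorUpTo-xor (suc n) h h′ =
    trans (cong ((h 0 xor h′ 0) xor_) (xorUpTo-xor n (λ k → h (suc k)) (λ k → h′ (suc k))))
          (xor-interchange (h 0) (h′ 0) _ _)

module Mex where

  open import Data.Nat using (ℕ; zero; suc; _+_; _≤_; _<_; z≤n; s≤s; _≤?_)
  open import Data.Nat.Properties
  open import Data.Bool using (Bool; true; false; _∧_; _∨_; _xor_; not)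
  open import Data.Bool.Properties using (∨-assoc; ∨-zeroʳ; ∨-identityʳ; ∨-idem; xor-identityʳ)
  open import Data.List using (List; []; _∷_; _++_; length; replicate)
  open import Data.List.Properties using (length-++; length-replicate)
  open import Data.List.Relation.Unary.All as All using (All; []; _∷_)
  open import Data.Product using (Σ-syntax; _×_; _,_)
  open import Data.Sum using (_⊎_; inj₁; inj₂)
  open import Relation.Nullary using (Dec; yes; no; contradiction)
  open import Relation.Nullary.Decidable using (⌊_⌋)
  open import Relation.Binary.PropositionalEquality
  open XorSum using (isOdd-suc)

  ⌊≟⌋-false : ∀ a i → a ≢ i → ⌊ a ≟ i ⌋ ≡ false
  ⌊≟⌋-false a i a≢i with a ≟ i
  ... | yes a≡i = contradiction a≡i a≢i
  ... | no _ = refl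

  ⌊≟⌋-true : ∀ {a i} → a ≡ i → ⌊ a ≟ i ⌋ ≡ true
  ⌊≟⌋-true {a} {i} a≡i with a ≟ i
  ... | yes _ = refl
  ... | no a≢i = contradiction a≡i a≢i

  ∈ᵇ-++ : ∀ xs ys i → (i ∈ᵇ (xs ++ ys)) ≡ ((i ∈ᵇ xs) ∨ (i ∈ᵇ ys))
  ∈ᵇ-++ [] ys i = refl
  ∈ᵇ-++ (x ∷ xs) ys i = trans (cong (⌊ x ≟ i ⌋ ∨_) (∈ᵇ-++ xs ys i)) (sym (∨-assoc ⌊ x ≟ i ⌋ _ _))

  ∈ᵇ-replicate : ∀ k a i → (i ∈ᵇ replicate (suc k) a) ≡ ⌊ a ≟ i ⌋
  ∈ᵇ-replicate zero a i = ∨-identityʳ _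
  ∈ᵇ-replicate (suc k) a i = trans (cong (⌊ a ≟ i ⌋ ∨_) (∈ᵇ-replicate k a i)) (∨-idem ⌊ a ≟ i ⌋)

  ∈ᵇ-replicate-++-other : ∀ k a μ j → j ≢ a → (j ∈ᵇ (replicate k a ++ μ)) ≡ (j ∈ᵇ μ)
  ∈ᵇ-replicate-++-other zero a μ j j≢a = refl
  ∈ᵇ-replicate-++-other (suc k) a μ j j≢a = trans (∈ᵇ-++ (replicate (suc k) a) μ j)
    (cong (_∨ (j ∈ᵇ μ)) (trans (∈ᵇ-replicate k a j) (⌊≟⌋-false a j (j≢a ∘ sym))))
    where open import Function using (_∘_)

  ∈ᵇ-replicate-++-self : ∀ k a μ → (a ∈ᵇ (replicate (suc k) a ++ μ)) ≡ true
  ∈ᵇ-replicate-++-self k a μ = trans (∈ᵇ-++ (replicate (suc k) a) μ a)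
    (cong (_∨ (a ∈ᵇ μ)) (trans (∈ᵇ-replicate k a a) (⌊≟⌋-true refl)))

  ∈ᵇ-++⁺ʳ : ∀ xs μ j → (j ∈ᵇ μ) ≡ true → (j ∈ᵇ (xs ++ μ)) ≡ true
  ∈ᵇ-++⁺ʳ xs μ j e = trans (∈ᵇ-++ xs μ j) (trans (cong ((j ∈ᵇ xs) ∨_) e) (∨-zeroʳ _))

  PartsIn : ℕ → List ℕ → Set
  PartsIn m μ = All (λ x → 1 ≤ x × x ≤ m) μ

  ∈ᵇ-above : ∀ m μ i → PartsIn m μ → m < i → (i ∈ᵇ μ) ≡ false
  ∈ᵇ-above m [] i [] m<i = refl
  ∈ᵇ-above m (x ∷ μ) i ((_ , x≤m) ∷ ps) m<i =
    trans (cong (_∨ (i ∈ᵇ μ)) (⌊≟⌋-false x i (λ { refl → <⇒≱ m<i x≤m }))) (∈ᵇ-above m μ i ps m<i)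

  record IsMex (xs : List ℕ) (i : ℕ) : Set where
    constructor mkIsMex
    field
      positive : 1 ≤ i
      below : ∀ j → 1 ≤ j → j < i → (j ∈ᵇ xs) ≡ true
      absent : (i ∈ᵇ xs) ≡ false
  open IsMex

  -- mex₁₁ only searches the candidates 1, …, length μ + 1; this invariant makes that fuel sufficient.
  FullPrefixBound : List ℕ → Set
  FullPrefixBound μ = ∀ i → (∀ j → 1 ≤ j → j ≤ i → (j ∈ᵇ μ) ≡ true) → i ≤ length μ

  mexSearch-isMex : ∀ xs f k i → k ≤ i → i < k + f → (∀ j → k ≤ j → j < i → (j ∈ᵇ xs) ≡ true) →
                    (i ∈ᵇ xs) ≡ false → mexSearch xs f k ≡ i
  mexSearch-isMex xs zero k i k≤i i<k+0 _ _ = contradiction (subst (i <_) (+-identityʳ k) i<k+0) (≤⇒≯ k≤i)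
  mexSearch-isMex xs (suc f) k i k≤i i<k+f smaller∈ i∉ with m≤n⇒m<n∨m≡n k≤i
  ... | inj₂ refl rewrite i∉ = refl
  ... | inj₁ k<i rewrite smaller∈ k ≤-refl k<i =
    mexSearch-isMex xs f (suc k) i k<i (subst (i <_) (+-suc k f) i<k+f)
      (λ j sk≤j j<i → smaller∈ j (≤-trans (n≤1+n k) sk≤j) j<i) i∉

  mex₁₁-isMex : ∀ μ v → FullPrefixBound μ → IsMex μ v → mex₁₁ μ ≡ v
  mex₁₁-isMex μ (suc v) bound m =
    mexSearch-isMex μ (suc (length μ)) 1 (suc v) (positive m) (s≤s (s≤s v≤length)) (below m) (absent m)
    where
    v≤length : v ≤ length μ
    v≤length = bound v (λ j p q → below m j p (s≤s q))

  prefix-or-gap : ∀ xs m → (∀ j → 1 ≤ j → j ≤ m → (j ∈ᵇ xs) ≡ true) ⊎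
                           (Σ[ i ∈ ℕ ] IsMex xs i × i ≤ m)
  prefix-or-gap xs zero = inj₁ (λ j 1≤j j≤0 → contradiction j≤0 (<⇒≱ 1≤j))
  prefix-or-gap xs (suc m) with prefix-or-gap xs m
  ... | inj₂ (i , isMex , i≤m) = inj₂ (i , isMex , ≤-trans i≤m (n≤1+n m))
  ... | inj₁ prefix with (suc m ∈ᵇ xs) in eq
  ...   | false = inj₂ (suc m , mkIsMex (s≤s z≤n) (λ j p q → prefix j p (m<1+n⇒m≤n q)) eq , ≤-refl)
  ...   | true = inj₁ λ j p q → case m≤n⇒m<n∨m≡n q of λ where
          (inj₁ j<sm) → prefix j p (m<1+n⇒m≤n j<sm)
          (inj₂ refl) → eq
    where open import Function using (case_of_)

  isMex-suc : ∀ m μ → PartsIn m μ → (∀ j → 1 ≤ j → j ≤ m → (j ∈ᵇ μ) ≡ true) → IsMex μ (suc m)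
  isMex-suc m μ ps prefix =
    mkIsMex (s≤s z≤n) (λ j p q → prefix j p (m<1+n⇒m≤n q)) (∈ᵇ-above m μ (suc m) ps ≤-refl)

  mex₁₁-bounded : ∀ m μ → PartsIn m μ → FullPrefixBound μ → IsMex μ (mex₁₁ μ) × mex₁₁ μ ≤ suc m
  mex₁₁-bounded m μ ps bound with prefix-or-gap μ m
  ... | inj₂ (i , isMex , i≤m) rewrite mex₁₁-isMex μ i bound isMex = isMex , ≤-trans i≤m (n≤1+n m)
  ... | inj₁ prefix rewrite mex₁₁-isMex μ (suc m) bound (isMex-suc m μ ps prefix) =
    isMex-suc m μ ps prefix , ≤-refl

  partsIn-replicate-++ : ∀ k m μ → PartsIn m μ → PartsIn (suc m) (replicate k (suc m) ++ μ)
  partsIn-replicate-++ zero m μ ps = All.map (λ { (1≤x , x≤m) → 1≤x , ≤-trans x≤m (n≤1+n m) }) ps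
  partsIn-replicate-++ (suc k) m μ ps = (s≤s z≤n , ≤-refl) ∷ partsIn-replicate-++ k m μ ps

  length-replicate-++ : ∀ k (a : ℕ) μ → length (replicate k a ++ μ) ≡ k + length μ
  length-replicate-++ k a μ = trans (length-++ (replicate k a)) (cong (_+ length μ) (length-replicate k))

  fullPrefixBound-replicate-++ : ∀ k m μ → PartsIn m μ → FullPrefixBound μ →
                                 FullPrefixBound (replicate k (suc m) ++ μ)
  fullPrefixBound-replicate-++ k m μ ps bound i prefix with i ≤? m
  ... | yes i≤m = ≤-trans (bound i prefixμ)
                          (subst (length μ ≤_) (sym (length-replicate-++ k (suc m) μ)) (m≤n+m (length μ) k))
    where
    prefixμ : ∀ j → 1 ≤ j → j ≤ i → (j ∈ᵇ μ) ≡ true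
    prefixμ j p q = trans (sym (∈ᵇ-replicate-++-other k (suc m) μ j (λ { refl → <⇒≱ (≤-trans q i≤m) ≤-refl })))
                          (prefix j p q)
  ... | no i≰m = go k prefix
    where
    m≤length : m ≤ length μ
    m≤length = bound m (λ j p q → trans (sym (∈ᵇ-replicate-++-other k (suc m) μ j (λ { refl → <⇒≱ q ≤-refl })))
                                        (prefix j p (≤-trans q (<⇒≤ (≰⇒> i≰m)))))
    go : ∀ k → (∀ j → 1 ≤ j → j ≤ i → (j ∈ᵇ (replicate k (suc m) ++ μ)) ≡ true) →
         i ≤ length (replicate k (suc m) ++ μ)
    go zero prefix′ =
      contradiction (trans (sym (prefix′ (suc m) (s≤s z≤n) (≰⇒> i≰m))) (∈ᵇ-above m μ (suc m) ps ≤-refl)) λ ()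
    go (suc k) prefix′ with i ≤? suc m
    ... | yes i≤sm = ≤-trans i≤sm (subst (suc m ≤_) (sym (length-replicate-++ (suc k) (suc m) μ))
                                         (s≤s (≤-trans m≤length (m≤n+m (length μ) k))))
    ... | no i≰sm = contradiction (trans (sym (prefix′ (suc (suc m)) (s≤s z≤n) (≰⇒> i≰sm)))
        (trans (∈ᵇ-replicate-++-other (suc k) (suc m) μ (suc (suc m)) (λ ()))
               (∈ᵇ-above m μ (suc (suc m)) ps (n≤1+n (suc m))))) λ ()

  mex₁₁-replicate-++-other : ∀ k m μ → PartsIn m μ → FullPrefixBound μ → mex₁₁ μ ≢ suc m →
                             mex₁₁ (replicate k (suc m) ++ μ) ≡ mex₁₁ μ
  mex₁₁-replicate-++-other k m μ ps bound mex≢ with mex₁₁-bounded m μ ps bound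
  ... | isMex , _ = mex₁₁-isMex (replicate k (suc m) ++ μ) (mex₁₁ μ) (fullPrefixBound-replicate-++ k m μ ps bound)
    (mkIsMex (positive isMex) (λ j p q → ∈ᵇ-++⁺ʳ (replicate k (suc m)) μ j (below isMex j p q))
             (trans (∈ᵇ-replicate-++-other k (suc m) μ (mex₁₁ μ) mex≢) (absent isMex)))

  mex₁₁-replicate-++-new : ∀ k m μ → PartsIn m μ → FullPrefixBound μ → mex₁₁ μ ≡ suc m →
                           mex₁₁ (replicate (suc k) (suc m) ++ μ) ≡ suc (suc m)
  mex₁₁-replicate-++-new k m μ ps bound mex≡ with mex₁₁-bounded m μ ps bound
  ... | isMex , _ = mex₁₁-isMex (replicate (suc k) (suc m) ++ μ) (suc (suc m))
                                 (fullPrefixBound-replicate-++ (suc k) m μ ps bound)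
    (mkIsMex (s≤s z≤n) below′ (trans (∈ᵇ-replicate-++-other (suc k) (suc m) μ (suc (suc m)) (λ ()))
                                     (∈ᵇ-above m μ (suc (suc m)) ps (n≤1+n (suc m)))))
    where
    below′ : ∀ j → 1 ≤ j → j < suc (suc m) → (j ∈ᵇ (replicate (suc k) (suc m) ++ μ)) ≡ true
    below′ j p q with m≤n⇒m<n∨m≡n (m<1+n⇒m≤n q)
    ... | inj₁ j<sm = ∈ᵇ-++⁺ʳ (replicate (suc k) (suc m)) μ j (below isMex j p (subst (j <_) (sym mex≡) j<sm))
    ... | inj₂ refl = ∈ᵇ-replicate-++-self k (suc m) μ

  WellFormed : ℕ → List ℕ → Set
  WellFormed m μ = PartsIn m μ × FullPrefixBound μ

  wellFormed-replicate-++ : ∀ k m μ → WellFormed m μ → WellFormed (suc m) (replicate k (suc m) ++ μ)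
  wellFormed-replicate-++ k m μ (ps , bound) = partsIn-replicate-++ k m μ ps , fullPrefixBound-replicate-++ k m μ ps bound

  positive? : ℕ → Bool
  positive? zero = false
  positive? (suc _) = true

  mexIsSuc : ℕ → List ℕ → Bool
  mexIsSuc m μ = ⌊ mex₁₁ μ ≟ suc m ⌋

  isOdd-mex₁₁-replicate-++ : ∀ k m μ → WellFormed m μ →
    isOdd (mex₁₁ (replicate k (suc m) ++ μ)) ≡ isOdd (mex₁₁ μ) xor (positive? k ∧ mexIsSuc m μ)
  isOdd-mex₁₁-replicate-++ zero m μ _ = sym (xor-identityʳ _)
  isOdd-mex₁₁-replicate-++ (suc k) m μ (ps , bound) = by-cases (mex₁₁ μ ≟ suc m)
    where
    open ≡-Reasoning
    xor-true : ∀ x → x xor true ≡ not x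
    xor-true true = refl
    xor-true false = refl
    by-cases : Dec (mex₁₁ μ ≡ suc m) →
      isOdd (mex₁₁ (replicate (suc k) (suc m) ++ μ)) ≡ isOdd (mex₁₁ μ) xor mexIsSuc m μ
    by-cases (no mex≢) = begin
      isOdd (mex₁₁ (replicate (suc k) (suc m) ++ μ))
        ≡⟨ cong isOdd (mex₁₁-replicate-++-other (suc k) m μ ps bound mex≢) ⟩
      isOdd (mex₁₁ μ)
        ≡⟨ xor-identityʳ _ ⟨
      isOdd (mex₁₁ μ) xor false
        ≡⟨ cong (isOdd (mex₁₁ μ) xor_) (⌊≟⌋-false _ _ mex≢) ⟨
      isOdd (mex₁₁ μ) xor mexIsSuc m μ ∎
    by-cases (yes mex≡) = begin
      isOdd (mex₁₁ (replicate (suc k) (suc m) ++ μ))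
        ≡⟨ cong isOdd (mex₁₁-replicate-++-new k m μ ps bound mex≡) ⟩
      isOdd (suc (suc m))
        ≡⟨ isOdd-suc (suc m) ⟩
      not (isOdd (suc m))
        ≡⟨ xor-true (isOdd (suc m)) ⟨
      isOdd (suc m) xor true
        ≡⟨ cong₂ (λ a b → isOdd a xor b) (sym mex≡) (sym (⌊≟⌋-true mex≡)) ⟩
      isOdd (mex₁₁ μ) xor mexIsSuc m μ ∎

  mexIsSuc-replicate-++ : ∀ k m μ → WellFormed m μ →
    mexIsSuc (suc m) (replicate k (suc m) ++ μ) ≡ positive? k ∧ mexIsSuc m μ
  mexIsSuc-replicate-++ zero m μ (ps , bound) with mex₁₁-bounded m μ ps bound
  ... | _ , mex≤ = ⌊≟⌋-false _ _ (λ mex≡ → <⇒≱ ≤-refl (subst (_≤ suc m) mex≡ mex≤))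
  mexIsSuc-replicate-++ (suc k) m μ (ps , bound) = by-cases (mex₁₁ μ ≟ suc m)
    where
    by-cases : Dec (mex₁₁ μ ≡ suc m) → mexIsSuc (suc m) (replicate (suc k) (suc m) ++ μ) ≡ mexIsSuc m μ
    by-cases (yes mex≡) = trans (cong (λ v → ⌊ v ≟ suc (suc m) ⌋) (mex₁₁-replicate-++-new k m μ ps bound mex≡))
                                (trans (⌊≟⌋-true refl) (sym (⌊≟⌋-true mex≡)))
    by-cases (no mex≢) = trans (cong (λ v → ⌊ v ≟ suc (suc m) ⌋)
                                     (mex₁₁-replicate-++-other (suc k) m μ ps bound mex≢))
                               (trans (mexIsSuc-replicate-++ zero m μ (ps , bound)) (sym (⌊≟⌋-false _ _ mex≢)))

module GeometricSeries where

  open import Data.Nat using (ℕ; suc; _+_; _*_; _∸_; _<_; _≤?_)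
  open import Data.Nat.Properties
  open import Data.Bool using (Bool; false; _∧_; _xor_)
  open import Data.Bool.Properties using (xor-assoc; xor-comm; xor-same; xor-identityʳ)
  open import Relation.Nullary using (yes; no; does)
  open import Relation.Nullary.Decidable using (dec-true; dec-false)
  open import Relation.Binary.PropositionalEquality
  open XorSum
  open Series
  open QBinomial using (factor; factor⊛)

  -- f ⊛ Σ_{k≥0} q^{dk} and f ⊛ Σ_{k≥1} q^{dk}; over 𝔽₂ the first is f / (1 + q^d).
  divFactor divFactorTail : ℕ → Series → Series
  divFactor d f n = xorUpTo (suc n) (λ k → does (k * d ≤? n) ∧ f (n ∸ k * d))
  divFactorTail d f n = xorUpTo n (λ k → does (suc k * d ≤? n) ∧ f (n ∸ suc k * d))

  module _ (m : ℕ) (f : Series) where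

    private
      ≤?-+ : ∀ a c → does (suc m + a ≤? suc m + c) ≡ does (a ≤? c)
      ≤?-+ a c with a ≤? c
      ... | yes a≤c = trans (dec-true (suc m + a ≤? suc m + c) (+-monoʳ-≤ (suc m) a≤c)) (sym (dec-true (a ≤? c) a≤c))
      ... | no a≰c = trans (dec-false (suc m + a ≤? suc m + c) (λ le → a≰c (+-cancelˡ-≤ (suc m) a c le)))
                           (sym (dec-false (a ≤? c) a≰c))

      term-vanishes : ∀ n k → n < k * suc m → (does (k * suc m ≤? n) ∧ f (n ∸ k * suc m)) ≡ false
      term-vanishes n k n<km rewrite dec-false (k * suc m ≤? n) (<⇒≱ n<km) = refl

    divFactor-below : ∀ n → n < suc m → divFactor (suc m) f n ≡ f n
    divFactor-below n n<d = trans
      (cong (f n xor_) (xorUpTo-false n _ (λ k _ → term-vanishes n (suc k) (<-≤-trans n<d (m≤n*m (suc m) (suc k))))))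
      (xor-identityʳ (f n))

    divFactor-+ : ∀ n → divFactor (suc m) f (suc m + n) ≡ f (suc m + n) xor divFactor (suc m) f n
    divFactor-+ n = cong (f (suc m + n) xor_) (begin
      xorUpTo (suc m + n) (λ k → does (suc k * suc m ≤? suc m + n) ∧ f (suc m + n ∸ suc k * suc m))
        ≡⟨ xorUpTo-cong-on (suc m + n) (λ k _ →
             cong₂ _∧_ (≤?-+ (k * suc m) n) (cong f ([m+n]∸[m+o]≡n∸o (suc m) n (k * suc m)))) ⟩
      xorUpTo (suc m + n) h
        ≡⟨ cong (λ z → xorUpTo (suc z) h) (+-comm m n) ⟩
      xorUpTo (suc n + m) h
        ≡⟨ xorUpTo-+ (suc n) m h (λ k n<k → term-vanishes n k (<-≤-trans n<k (m≤m*n k (suc m)))) ⟩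
      xorUpTo (suc n) h ∎)
      where
      open ≡-Reasoning
      h : ℕ → Bool
      h k = does (k * suc m ≤? n) ∧ f (n ∸ k * suc m)

    divFactor-coeff : ∀ n → divFactor (suc m) f n xor shift (suc m) (divFactor (suc m) f) n ≡ f n
    divFactor-coeff n with suc m ≤? n
    ... | no d≰n = trans (cong (divFactor (suc m) f n xor_) (shift-below (suc m) _ n (≰⇒> d≰n)))
                         (trans (xor-identityʳ _) (divFactor-below n (≰⇒> d≰n)))
    ... | yes d≤n = subst (λ z → divFactor (suc m) f z xor shift (suc m) (divFactor (suc m) f) z ≡ f z)
                          (m+[n∸m]≡n d≤n)
        (trans (cong₂ _xor_ (divFactor-+ (n ∸ suc m)) (shift-+ (suc m) (divFactor (suc m) f) (n ∸ suc m)))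
               (xor-cancelʳ _ _))
      where
      xor-cancelʳ : ∀ a c → (a xor c) xor c ≡ a
      xor-cancelʳ a c = trans (xor-assoc a c c) (trans (cong (a xor_) (xor-same c)) (xor-identityʳ a))

    factor⊛divFactor : factor (suc m) ⊛ divFactor (suc m) f ≈ f
    factor⊛divFactor = ≈-trans (factor⊛ (suc m) (divFactor (suc m) f))
      (≈-trans (⊕-cong ≈-refl (X⊛≈shift (suc m) _))
               (mk≈ (λ n → trans (⊕-coeff _ _ n) (divFactor-coeff n))))

    divFactorTail≈ : divFactorTail (suc m) f ≈ divFactor (suc m) f ⊕ f
    divFactorTail≈ = mk≈ λ n → sym (trans (⊕-coeff _ f n)
      (trans (cong (_xor f n) (xor-comm (f n) (divFactorTail (suc m) f n)))
      (trans (xor-assoc (divFactorTail (suc m) f n) (f n) (f n))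
      (trans (cong (divFactorTail (suc m) f n xor_) (xor-same (f n))) (xor-identityʳ _)))))

    factor⊛divFactorTail : factor (suc m) ⊛ divFactorTail (suc m) f ≈ X (suc m) ⊛ f
    factor⊛divFactorTail = begin
      factor (suc m) ⊛ divFactorTail (suc m) f                    ≈⟨ ⊛-cong ≈-refl divFactorTail≈ ⟩
      factor (suc m) ⊛ (divFactor (suc m) f ⊕ f)                  ≈⟨ ⊛-distribˡ-⊕ _ _ _ ⟩
      factor (suc m) ⊛ divFactor (suc m) f ⊕ factor (suc m) ⊛ f
                                                                  ≈⟨ ⊕-cong factor⊛divFactor (factor⊛ (suc m) f) ⟩
      f ⊕ (f ⊕ X (suc m) ⊛ f)                                     ≈⟨ ⊕-cancelˡ f _ ⟩
      X (suc m) ⊛ f                                               ∎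
      where open import Relation.Binary.Reasoning.Setoid Series-setoid

module PartitionSeries where

  open import Data.Nat using (ℕ; zero; suc; _*_; _∸_; z≤n; s≤s; _≤?_)
  open import Data.Bool using (Bool; _∧_; _xor_)
  open import Data.Bool.Properties using (∧-distribˡ-xor)
  open import Data.List using (List; []; _∷_; _++_; replicate; map; concatMap; filter; upTo)
  open import Data.List.Relation.Unary.All as All using (All; []; _∷_)
  open import Data.List.Relation.Unary.All.Properties using (map⁺; concat⁺)
  open import Data.Product using (_,_)
  open import Relation.Nullary using (does; contradiction)
  open import Relation.Binary.PropositionalEquality
  open XorSum
  open Mex
  open Series
  open QBinomial using (factor; eulerProd; tri)
  open Jacobi using (ψ; ψ-suc)
  open GeometricSeries
  import Relation.Binary.Reasoning.Setoid Series-setoid as ≈-Reasoning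

  partitionsBounded-wellFormed : ∀ m n → All (WellFormed m) (partitionsBounded m n)
  partitionsBounded-wellFormed zero zero = ([] , empty-bound) ∷ []
    where
    empty-bound : FullPrefixBound []
    empty-bound zero _ = z≤n
    empty-bound (suc i) prefix = contradiction (prefix 1 (s≤s z≤n) (s≤s z≤n)) λ ()
  partitionsBounded-wellFormed zero (suc n) = []
  partitionsBounded-wellFormed (suc m) n = concat⁺ (map⁺ (All.universal (λ k →
    map⁺ (All.map (wellFormed-replicate-++ k m _) (partitionsBounded-wellFormed m (n ∸ k * suc m))))
    (filter (λ k → k * suc m ≤? n) (upTo (suc n)))))

  oddMexSeries mexSucSeries : ℕ → Series
  oddMexSeries m n = xorSum (λ μ → isOdd (mex₁₁ μ)) (partitionsBounded m n)
  mexSucSeries m n = xorSum (mexIsSuc m) (partitionsBounded m n)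

  xorSum-partitionsBounded-suc : ∀ (g : List ℕ → Bool) m n →
    xorSum g (partitionsBounded (suc m) n) ≡
    xorUpTo (suc n) (λ k → does (k * suc m ≤? n) ∧
      xorSum (λ μ → g (replicate k (suc m) ++ μ)) (partitionsBounded m (n ∸ k * suc m)))
  xorSum-partitionsBounded-suc g m n = begin
    xorSum g (concatMap blocks (filter (λ k → k * suc m ≤? n) (upTo (suc n))))
      ≡⟨ xorSum-concatMap g blocks (filter (λ k → k * suc m ≤? n) (upTo (suc n))) ⟩
    xorSum (λ k → xorSum g (blocks k)) (filter (λ k → k * suc m ≤? n) (upTo (suc n)))
      ≡⟨ xorSum-filter (λ k → k * suc m ≤? n) (λ k → xorSum g (blocks k)) (upTo (suc n)) ⟩
    xorSum (λ k → does (k * suc m ≤? n) ∧ xorSum g (blocks k)) (upTo (suc n))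
      ≡⟨ xorSum-applyUpTo (λ k → does (k * suc m ≤? n) ∧ xorSum g (blocks k)) (λ k → k) (suc n) ⟩
    xorUpTo (suc n) (λ k → does (k * suc m ≤? n) ∧ xorSum g (blocks k))
      ≡⟨ xorUpTo-cong-on (suc n) (λ k _ → cong (does (k * suc m ≤? n) ∧_)
           (xorSum-map g (replicate k (suc m) ++_) (partitionsBounded m (n ∸ k * suc m)))) ⟩
    xorUpTo (suc n) (λ k → does (k * suc m ≤? n) ∧
      xorSum (λ μ → g (replicate k (suc m) ++ μ)) (partitionsBounded m (n ∸ k * suc m))) ∎
    where
    open ≡-Reasoning
    blocks : ℕ → List (List ℕ)
    blocks k = map (replicate k (suc m) ++_) (partitionsBounded m (n ∸ k * suc m))

  mexSucSeries-suc : ∀ m → mexSucSeries (suc m) ≈ divFactorTail (suc m) (mexSucSeries m)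
  mexSucSeries-suc m = mk≈ λ n → trans (xorSum-partitionsBounded-suc (mexIsSuc (suc m)) m n)
    (xorUpTo-cong-on (suc n) λ k _ → cong (does (k * suc m ≤? n) ∧_) (begin
      xorSum (λ μ → mexIsSuc (suc m) (replicate k (suc m) ++ μ)) (partitionsBounded m (n ∸ k * suc m))
        ≡⟨ xorSum-cong-All _ _ (partitionsBounded-wellFormed m _) (mexIsSuc-replicate-++ k m _) ⟩
      xorSum (λ μ → positive? k ∧ mexIsSuc m μ) (partitionsBounded m (n ∸ k * suc m))
        ≡⟨ xorSum-∧ˡ (positive? k) (mexIsSuc m) (partitionsBounded m (n ∸ k * suc m)) ⟩
      positive? k ∧ mexSucSeries m (n ∸ k * suc m) ∎))
    where open ≡-Reasoning

  oddMexSeries-suc : ∀ m →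
    oddMexSeries (suc m) ≈ divFactor (suc m) (oddMexSeries m) ⊕ divFactorTail (suc m) (mexSucSeries m)
  oddMexSeries-suc m = mk≈ λ n → begin
    oddMexSeries (suc m) n
      ≡⟨ xorSum-partitionsBounded-suc (λ μ → isOdd (mex₁₁ μ)) m n ⟩
    xorUpTo (suc n) (λ k → does (k * suc m ≤? n) ∧
      xorSum (λ μ → isOdd (mex₁₁ (replicate k (suc m) ++ μ))) (partitionsBounded m (n ∸ k * suc m)))
      ≡⟨ xorUpTo-cong-on (suc n) (λ k _ → trans (cong (does (k * suc m ≤? n) ∧_) (split k (n ∸ k * suc m)))
                                                 (∧-distribˡ-xor (does (k * suc m ≤? n)) (oddMexSeries m (n ∸ k * suc m))
                                                                 (positive? k ∧ mexSucSeries m (n ∸ k * suc m)))) ⟩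
    xorUpTo (suc n) (λ k → (does (k * suc m ≤? n) ∧ oddMexSeries m (n ∸ k * suc m)) xor
                           (does (k * suc m ≤? n) ∧ (positive? k ∧ mexSucSeries m (n ∸ k * suc m))))
      ≡⟨ xorUpTo-xor (suc n) (λ k → does (k * suc m ≤? n) ∧ oddMexSeries m (n ∸ k * suc m))
                             (λ k → does (k * suc m ≤? n) ∧ (positive? k ∧ mexSucSeries m (n ∸ k * suc m))) ⟩
    divFactor (suc m) (oddMexSeries m) n xor divFactorTail (suc m) (mexSucSeries m) n
      ≡⟨ ⊕-coeff _ _ n ⟨
    (divFactor (suc m) (oddMexSeries m) ⊕ divFactorTail (suc m) (mexSucSeries m)) n ∎
    where
    open ≡-Reasoning
    split : ∀ k r → xorSum (λ μ → isOdd (mex₁₁ (replicate k (suc m) ++ μ))) (partitionsBounded m r) ≡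
                    oddMexSeries m r xor (positive? k ∧ mexSucSeries m r)
    split k r = trans (xorSum-cong-All _ _ (partitionsBounded-wellFormed m r) (isOdd-mex₁₁-replicate-++ k m _))
      (trans (xorSum-xor _ _ (partitionsBounded m r))
             (cong (oddMexSeries m r xor_) (xorSum-∧ˡ (positive? k) (mexIsSuc m) (partitionsBounded m r))))

  oddMexSeries-zero : oddMexSeries 0 ≈ 𝟙
  oddMexSeries-zero = mk≈ λ { zero → sym (X-coeff 0 0) ; (suc n) → sym (X-coeff 0 (suc n)) }

  mexSucSeries-zero : mexSucSeries 0 ≈ 𝟙
  mexSucSeries-zero = mk≈ λ { zero → sym (X-coeff 0 0) ; (suc n) → sym (X-coeff 0 (suc n)) }

  eulerProd⊛mexSucSeries : ∀ m → eulerProd m ⊛ mexSucSeries m ≈ X (tri m)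
  eulerProd⊛mexSucSeries zero = ≈-trans (⊛-identityˡ _) mexSucSeries-zero
  eulerProd⊛mexSucSeries (suc m) = begin
    (eulerProd m ⊛ factor (suc m)) ⊛ mexSucSeries (suc m)  ≈⟨ ⊛-assoc _ _ _ ⟩
    eulerProd m ⊛ (factor (suc m) ⊛ mexSucSeries (suc m))
                                                           ≈⟨ ⊛-cong ≈-refl (⊛-cong ≈-refl (mexSucSeries-suc m)) ⟩
    eulerProd m ⊛ (factor (suc m) ⊛ divFactorTail (suc m) (mexSucSeries m))
                                                           ≈⟨ ⊛-cong ≈-refl (factor⊛divFactorTail m (mexSucSeries m)) ⟩
    eulerProd m ⊛ (X (suc m) ⊛ mexSucSeries m)             ≈⟨ ⊛-swapˡ _ _ _ ⟩
    X (suc m) ⊛ (eulerProd m ⊛ mexSucSeries m)             ≈⟨ ⊛-cong ≈-refl (eulerProd⊛mexSucSeries m) ⟩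
    X (suc m) ⊛ X (tri m)                                  ≈⟨ X⊛X _ _ ⟩
    X (tri (suc m))                                        ∎
    where open ≈-Reasoning

  eulerProd⊛oddMexSeries : ∀ m → eulerProd m ⊛ oddMexSeries m ≈ ψ m
  eulerProd⊛oddMexSeries zero = ≈-trans (⊛-identityˡ _) oddMexSeries-zero
  eulerProd⊛oddMexSeries (suc m) = begin
    (eulerProd m ⊛ factor (suc m)) ⊛ oddMexSeries (suc m)
      ≈⟨ ⊛-assoc _ _ _ ⟩
    eulerProd m ⊛ (factor (suc m) ⊛ oddMexSeries (suc m))
      ≈⟨ ⊛-cong ≈-refl (⊛-cong ≈-refl (oddMexSeries-suc m)) ⟩
    eulerProd m ⊛ (factor (suc m) ⊛ (divFactor (suc m) (oddMexSeries m) ⊕ divFactorTail (suc m) (mexSucSeries m)))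
      ≈⟨ ⊛-cong ≈-refl (≈-trans (⊛-distribˡ-⊕ _ _ _)
           (⊕-cong (factor⊛divFactor m (oddMexSeries m)) (factor⊛divFactorTail m (mexSucSeries m)))) ⟩
    eulerProd m ⊛ (oddMexSeries m ⊕ X (suc m) ⊛ mexSucSeries m)
      ≈⟨ ⊛-distribˡ-⊕ _ _ _ ⟩
    eulerProd m ⊛ oddMexSeries m ⊕ eulerProd m ⊛ (X (suc m) ⊛ mexSucSeries m)
      ≈⟨ ⊕-cong (eulerProd⊛oddMexSeries m) (⊛-swapˡ _ _ _) ⟩
    ψ m ⊕ X (suc m) ⊛ (eulerProd m ⊛ mexSucSeries m)
      ≈⟨ ⊕-cong ≈-refl (≈-trans (⊛-cong ≈-refl (eulerProd⊛mexSucSeries m)) (X⊛X _ _)) ⟩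
    ψ m ⊕ X (tri (suc m))
      ≈⟨ ψ-suc m ⟨
    ψ (suc m) ∎
    where open ≈-Reasoning

  isOdd-p₁₁ : ∀ N → isOdd (p₁₁ N) ≡ oddMexSeries N N
  isOdd-p₁₁ N = isOdd-length-filter (λ μ → isOdd (mex₁₁ μ)) (partitions N)

module NumberTheory where

  open import Data.Nat using (ℕ; zero; suc; _+_; _*_; _∸_; _^_; _≤_; _<_; z≤n; s≤s; _%_; _/_; NonZero)
  open import Data.Nat.Properties
  open import Data.Nat.Divisibility using (_∣_; divides; ∣-trans; ∣m∣n⇒∣m+n; ∣m+n∣m⇒∣n; n∣m*n; ∣⇒≤)
  open import Data.Nat.DivMod using (m≡m%n+[m/n]*n; m%n<n; %-distribˡ-*; m*n/n≡m)
  open import Data.Nat.Primality using (Prime; euclidsLemma; prime⇒irreducible; prime⇒nonZero)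
  open import Data.Nat.Solver using (module +-*-Solver)
  open import Data.Sum using (inj₁; inj₂)
  open import Relation.Nullary using (¬_; contradiction)
  open import Relation.Binary.PropositionalEquality
  open +-*-Solver using (solve; _:=_; _:+_; _:*_; con)

  module _ {p : ℕ} (p-prime : Prime p) (5≤p : 5 ≤ p) where

    private instance
      p-nonZero : NonZero p
      p-nonZero = prime⇒nonZero p-prime

    private
      ∤p-below-5 : ∀ d → 1 < d → d < 5 → ¬ (d ∣ p)
      ∤p-below-5 d 1<d d<5 d∣p with prime⇒irreducible p-prime d∣p
      ... | inj₁ refl = <-irrefl refl 1<d
      ... | inj₂ refl = <⇒≱ d<5 5≤p

      ∣p-via-residue : ∀ d r → p % 12 ≡ r → d ∣ r → d ∣ 12 → d ∣ p
      ∣p-via-residue d r p%12≡r d∣r d∣12 =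
        subst (d ∣_) (sym (trans (m≡m%n+[m/n]*n p 12) (cong (_+ (p / 12) * 12) p%12≡r)))
              (∣m∣n⇒∣m+n d∣r (∣-trans d∣12 (n∣m*n (p / 12))))

    p*p%12≡1 : (p * p) % 12 ≡ 1
    p*p%12≡1 = trans (%-distribˡ-* p p 12) (by-residue (p % 12) refl (m%n<n p 12))
      where
      even : ∀ r → p % 12 ≡ r → 2 ∣ r → (r * r) % 12 ≡ 1
      even r e 2∣r = contradiction (∣p-via-residue 2 r e 2∣r (divides 6 refl))
                                   (∤p-below-5 2 (s≤s (s≤s z≤n)) (s≤s (s≤s (s≤s z≤n))))
      triple : ∀ r → p % 12 ≡ r → 3 ∣ r → (r * r) % 12 ≡ 1
      triple r e 3∣r = contradiction (∣p-via-residue 3 r e 3∣r (divides 4 refl))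
                                     (∤p-below-5 3 (s≤s (s≤s z≤n)) (s≤s (s≤s (s≤s (s≤s z≤n)))))
      by-residue : ∀ r → p % 12 ≡ r → r < 12 → (r * r) % 12 ≡ 1
      by-residue 0 e _ = even 0 e (divides 0 refl)
      by-residue 1 e _ = refl
      by-residue 2 e _ = even 2 e (divides 1 refl)
      by-residue 3 e _ = triple 3 e (divides 1 refl)
      by-residue 4 e _ = even 4 e (divides 2 refl)
      by-residue 5 e _ = refl
      by-residue 6 e _ = even 6 e (divides 3 refl)
      by-residue 7 e _ = refl
      by-residue 8 e _ = even 8 e (divides 4 refl)
      by-residue 9 e _ = triple 9 e (divides 3 refl)
      by-residue 10 e _ = even 10 e (divides 5 refl)
      by-residue 11 e _ = refl
      by-residue (suc (suc (suc (suc (suc (suc (suc (suc (suc (suc (suc (suc r)))))))))))) e r<12 =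
        contradiction r<12 (≤⇒≯ (m≤m+n 12 r))

    p^even%12≡1 : ∀ j → p ^ (j + j) % 12 ≡ 1
    p^even%12≡1 j = subst (λ x → x % 12 ≡ 1) (sym (p^2j≡[p*p]^j j)) (power-%12 j)
      where
      p^2j≡[p*p]^j : ∀ j → p ^ (j + j) ≡ (p * p) ^ j
      p^2j≡[p*p]^j zero = refl
      p^2j≡[p*p]^j (suc j) = trans (cong (λ e → p * p ^ e) (+-suc j j))
        (trans (sym (*-assoc p p (p ^ (j + j)))) (cong ((p * p) *_) (p^2j≡[p*p]^j j)))
      power-%12 : ∀ j → ((p * p) ^ j) % 12 ≡ 1
      power-%12 zero = refl
      power-%12 (suc j) = trans (%-distribˡ-* (p * p) ((p * p) ^ j) 12)
        (cong₂ (λ a c → (a * c) % 12) p*p%12≡1 (power-%12 j))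

    12N+1≡ : ∀ k n → 12 * (p ^ (2 * k + 1) * n + (p ^ (2 * k + 2) ∸ 1) / 12) + 1 ≡ p ^ (2 * k + 1) * (12 * n + p)
    12N+1≡ k n = begin
      12 * (q * n + (p^2k+2 ∸ 1) / 12) + 1  ≡⟨ cong (λ z → 12 * (q * n + z) + 1) quotient ⟩
      12 * (q * n + a) + 1                  ≡⟨ solve 3 (λ q n a → con 12 :* (q :* n :+ a) :+ con 1
                                                               := con 12 :* q :* n :+ (con 1 :+ a :* con 12)) refl q n a ⟩
      12 * q * n + (1 + a * 12)             ≡⟨ cong (12 * q * n +_) p^2k+2≡ ⟨
      12 * q * n + p^2k+2                   ≡⟨ cong (λ e → 12 * q * n + p ^ e) (+-suc (2 * k) 1) ⟩
      12 * q * n + p * q                    ≡⟨ solve 3 (λ q n p → con 12 :* q :* n :+ p :* q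
                                                               := q :* (con 12 :* n :+ p)) refl q n p ⟩
      q * (12 * n + p)                      ∎
      where
      open ≡-Reasoning
      q = p ^ (2 * k + 1)
      p^2k+2 = p ^ (2 * k + 2)
      a = p^2k+2 / 12
      p^2k+2≡ : p^2k+2 ≡ 1 + a * 12
      p^2k+2≡ = trans (m≡m%n+[m/n]*n p^2k+2 12) (cong (_+ a * 12)
        (subst (λ e → p ^ e % 12 ≡ 1) (solve 1 (λ k → (con 1 :+ k) :+ (con 1 :+ k) := con 2 :* k :+ con 2) refl k)
               (p^even%12≡1 (suc k))))
      quotient : (p^2k+2 ∸ 1) / 12 ≡ a
      quotient = trans (cong (λ z → (z ∸ 1) / 12) p^2k+2≡) (trans (cong (_/ 12) (m+n∸m≡n 1 (a * 12))) (m*n/n≡m a 12))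

    private
      p∤below-5 : ∀ d → suc d < 5 → ¬ (p ∣ suc d)
      p∤below-5 d sd<5 p∣sd = <⇒≱ sd<5 (≤-trans 5≤p (∣⇒≤ p∣sd))

      p∤12 : ¬ (p ∣ 12)
      p∤12 p∣12 with euclidsLemma 4 3 p-prime p∣12
      ... | inj₂ p∣3 = p∤below-5 2 (s≤s (s≤s (s≤s (s≤s z≤n)))) p∣3
      ... | inj₁ p∣4 with euclidsLemma 2 2 p-prime p∣4
      ...   | inj₁ p∣2 = p∤below-5 1 (s≤s (s≤s (s≤s z≤n))) p∣2
      ...   | inj₂ p∣2 = p∤below-5 1 (s≤s (s≤s (s≤s z≤n))) p∣2

    ∤12*n+p : ∀ n → ¬ (p ∣ n) → ¬ (p ∣ 12 * n + p)
    ∤12*n+p n p∤n p∣12n+p with euclidsLemma 12 n p-prime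
      (∣m+n∣m⇒∣n (subst (p ∣_) (+-comm (12 * n) p) p∣12n+p) (divides 1 (sym (*-identityˡ p))))
    ... | inj₁ p∣12 = p∤12 p∣12
    ... | inj₂ p∣n = p∤n p∣n

    -- The exponent of p in p^(2k+1) u is odd, whereas in a square it is even.
    p^odd*u≢square : ∀ k s u → ¬ (p ∣ u) → p ^ suc (k + k) * u ≢ s * s
    p^odd*u≢square k s u p∤u e with p∣s (divides (p ^ (k + k) * u)
      (trans (sym e) (trans (*-assoc p (p ^ (k + k)) u) (*-comm p _))))
      where
      p∣s : p ∣ s * s → p ∣ s
      p∣s p∣s² with euclidsLemma s s p-prime p∣s²
      ... | inj₁ p∣s = p∣s
      ... | inj₂ p∣s = p∣s
    p^odd*u≢square zero .(t * p) u p∤u e | divides t refl =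
      p∤u (divides (t * t) (*-cancelˡ-≡ u (t * t * p) p
        (trans (solve 2 (λ p u → p :* u := p :* con 1 :* u) refl p u)
        (trans e (solve 2 (λ t p → t :* p :* (t :* p) := p :* (t :* t :* p)) refl t p)))))
    p^odd*u≢square (suc k) .(t * p) u p∤u e | divides t refl =
      p^odd*u≢square k t u p∤u (*-cancelˡ-≡ _ _ p (*-cancelˡ-≡ _ _ p
        (trans (solve 3 (λ p Q u → p :* (p :* (p :* Q :* u)) := p :* (p :* (p :* Q)) :* u) refl p Q u)
        (trans (cong (_* u) (sym p^odd≡))
        (trans e (solve 2 (λ t p → t :* p :* (t :* p) := p :* (p :* (t :* t))) refl t p))))))
      where
      Q = p ^ (k + k)
      p^odd≡ : p ^ suc (suc k + suc k) ≡ p * (p * (p * Q))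
      p^odd≡ = cong (λ z → p * (p * p ^ z)) (+-suc k k)

    12N+1≢square : ∀ k n → ¬ (p ∣ n) → ∀ s →
                   12 * (p ^ (2 * k + 1) * n + (p ^ (2 * k + 2) ∸ 1) / 12) + 1 ≢ s * s
    12N+1≢square k n p∤n s 12N+1≡s² = p^odd*u≢square k s (12 * n + p) (∤12*n+p n p∤n) (begin
      p ^ suc (k + k) * (12 * n + p)
        ≡⟨ cong (λ e → p ^ e * (12 * n + p)) (solve 1 (λ k → con 1 :+ (k :+ k) := con 2 :* k :+ con 1) refl k) ⟩
      p ^ (2 * k + 1) * (12 * n + p)
        ≡⟨ 12N+1≡ k n ⟨
      12 * (p ^ (2 * k + 1) * n + (p ^ (2 * k + 2) ∸ 1) / 12) + 1
        ≡⟨ 12N+1≡s² ⟩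
      s * s ∎)
      where open ≡-Reasoning

open import Data.Nat.Divisibility using (_∣?_)
open import Data.Bool using (true)
open import Data.Product using (∃-syntax; _,_)
open import Relation.Nullary.Decidable using (decidable-stable)
open import Relation.Binary.PropositionalEquality using (_≡_; module ≡-Reasoning)
open XorSum using (2∤⇒isOdd)
open Frobenius using (sq)
open QBinomial using (eulerProd)
open SquareCriterion
open PartitionSeries
open NumberTheory

p₁₁-odd⇒square : ∀ N → ¬ (2 ∣ p₁₁ N) → ∃[ s ] 12 * N + 1 ≡ s * s
p₁₁-odd⇒square N 2∤p₁₁ = sq-eulerProd-support N (begin
  sq (eulerProd N) N   ≡⟨ sq-eulerProd-coeff N (oddMexSeries N) (eulerProd⊛oddMexSeries N) ⟩
  oddMexSeries N N     ≡⟨ isOdd-p₁₁ N ⟨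
  isOdd (p₁₁ N)        ≡⟨ 2∤⇒isOdd (p₁₁ N) 2∤p₁₁ ⟩
  true                 ∎)
  where open ≡-Reasoning

theorem3p3 : ∀ (p : ℕ) → Prime p → 5 ≤ p → p % 12 ≢ 1 →
    ∀ (k n : ℕ) → ¬ (p ∣ n) →
    2 ∣ p₁₁ (p ^ (2 * k + 1) * n + (p ^ (2 * k + 2) ∸ 1) / 12)
theorem3p3 p p-prime 5≤p _ k n p∤n = decidable-stable (2 ∣? p₁₁ N) λ 2∤p₁₁ →
  let s , 12N+1≡s² = p₁₁-odd⇒square N 2∤p₁₁ in 12N+1≢square p-prime 5≤p k n p∤n s 12N+1≡s²
  where
  N = p ^ (2 * k + 1) * n + (p ^ (2 * k + 2) ∸ 1) / 12
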